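{- Let $\Gamma$ be a graph whose line graph $L(\Gamma)$ is a Neumaier graph. Then $L(\Gamma)$ is isomorphic to one of: (1) the $(s+1)\times(s+1)$ rook graph (the line graph of $K_{s+1,s+1}$) for some integer $s\ge 1$; (2) the Johnson graph $J(s+2,2)$ for some integer $s\ge 2$; (3) the octahedral graph. In particular, $L(\Gamma)$ is strongly regular.
   Context: A graph is edge-regular if it is regular and any two adjacent vertices have the same number of common neighbours. A clique $C$ in a regular graph is a regular clique if every vertex outside $C$ is adjacent to the same positive number of vertices of $C$. A Neumaier graph is a non-complete edge-regular graph containing a regular clique. -}

module Defs where

open import Data.Nat using (ℕ; zero; suc; _+_)
import Data.Nat as ℕ
open import Data.Bool using (Bool; true; false; _∧_; _∨_; not; if_then_else_)
open import Data.Fin using (Fin; zero; suc; _<_; toℕ)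
open import Data.Fin.Properties using (_≟_)
open import Data.Product using (Σ; _×_; _,_; ∃; proj₁; proj₂)
open import Data.Sum using (_⊎_)
open import Function.Bundles using (_↔_; Inverse)
open import Relation.Binary.PropositionalEquality using (_≡_; _≢_)
open import Relation.Nullary.Decidable using (⌊_⌋)

record Graph : Set where
  field
    n      : ℕ
    adj    : Fin n → Fin n → Bool
    sym    : ∀ u v → adj u v ≡ adj v u
    irrefl : ∀ v → adj v v ≡ false
open Graph public

count : ∀ {n} → (Fin n → Bool) → ℕ
count {zero}  p = 0
count {suc n} p = (if p zero then 1 else 0) + count (λ i → p (suc i))

degree : (G : Graph) → Fin (n G) → ℕ
degree G v = count (λ w → adj G v w)

commonNeighbours : (G : Graph) → Fin (n G) → Fin (n G) → ℕ
commonNeighbours G u v = count (λ w → adj G u w ∧ adj G v w)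

IsRegular : Graph → ℕ → Set
IsRegular G k = ∀ v → degree G v ≡ k

IsEdgeRegular : Graph → Set
IsEdgeRegular G = Σ ℕ λ k → Σ ℕ λ l →
  IsRegular G k × (∀ u v → adj G u v ≡ true → commonNeighbours G u v ≡ l)

IsComplete : Graph → Set
IsComplete G = ∀ u v → u ≢ v → adj G u v ≡ true

IsClique : (G : Graph) → (Fin (n G) → Bool) → Set
IsClique G C = ∀ u v → C u ≡ true → C v ≡ true → u ≢ v → adj G u v ≡ true

IsRegularClique : (G : Graph) → (Fin (n G) → Bool) → Set
IsRegularClique G C = IsClique G C × (Σ ℕ λ e → 0 ℕ.< e ×
  (∀ v → C v ≡ false → count (λ w → C w ∧ adj G v w) ≡ e))

IsNeumaier : Graph → Set
IsNeumaier G = (IsComplete G → Data.Empty.⊥) × IsEdgeRegular G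
               × (Σ (Fin (n G) → Bool) λ C → IsRegularClique G C)
  where import Data.Empty

IsStronglyRegular : Graph → Set
IsStronglyRegular G = Σ ℕ λ k → Σ ℕ λ l → Σ ℕ λ m →
  IsRegular G k
  × (∀ u v → adj G u v ≡ true → commonNeighbours G u v ≡ l)
  × (∀ u v → u ≢ v → adj G u v ≡ false → commonNeighbours G u v ≡ m)

_≅_on_ : Graph → (V : Set) → (V → V → Bool) → Set
G ≅ V on R = Σ (Fin (n G) ↔ V) λ f →
  ∀ u v → R (Inverse.to f u) (Inverse.to f v) ≡ adj G u v

eqF : ∀ {m} → Fin m → Fin m → Bool
eqF a b = ⌊ a ≟ b ⌋

Edge : Graph → Set
Edge Γ = Σ (Fin (n Γ) × Fin (n Γ)) λ p → (proj₁ p < proj₂ p) × (adj Γ (proj₁ p) (proj₂ p) ≡ true)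

pairAdj : ∀ {m} → (Σ (Fin m × Fin m) λ p → proj₁ p < proj₂ p)
                → (Σ (Fin m × Fin m) λ p → proj₁ p < proj₂ p) → Bool
pairAdj ((a , b) , _) ((c , d) , _) =
  not (eqF a c ∧ eqF b d) ∧ (eqF a c ∨ eqF a d ∨ eqF b c ∨ eqF b d)

lineAdj : (Γ : Graph) → Edge Γ → Edge Γ → Bool
lineAdj Γ ((a , b) , _) ((c , d) , _) =
  not (eqF a c ∧ eqF b d) ∧ (eqF a c ∨ eqF a d ∨ eqF b c ∨ eqF b d)

IsLineGraphOf : Graph → Graph → Set
IsLineGraphOf L Γ = L ≅ Edge Γ on lineAdj Γ

rookAdj : (m : ℕ) → Fin m × Fin m → Fin m × Fin m → Bool
rookAdj m (a , b) (c , d) = not (eqF a c ∧ eqF b d) ∧ (eqF a c ∨ eqF b d)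

JVert : ℕ → Set
JVert m = Σ (Fin m × Fin m) λ p → proj₁ p < proj₂ p

johnsonAdj : (m : ℕ) → JVert m → JVert m → Bool
johnsonAdj m = pairAdj

-- octahedral graph K_{2,2,2}: vertices 0..5, non-adjacent pairs {i, i+3}
octaAdj : Fin 6 → Fin 6 → Bool
octaAdj u v = not ⌊ toℕ u ℕ.% 3 ℕ.≟ toℕ v ℕ.% 3 ⌋

-- Let C be a regular clique of L = L(Γ), with nexus e ≥ 1. Counting in the line graph gives
-- deg_L(uv) = deg u + deg v - 2, so k + 2 = deg u + deg v along every edge of Γ; adjacent edges
-- ab, ac have deg a - 2 + [b ~ c] common neighbours, and disjoint edges ab, cd have
-- [a ~ c] + [a ~ d] + [b ~ c] + [b ~ d]. A clique of L(Γ) with at least two edges lies in the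
-- star of a vertex x or in a triangle. In the triangle case every edge of Γ meets the triangle
-- (since e ≥ 1), and regularity forces Γ to be K₄ plus isolated vertices. In the star case C is
-- the whole star of x, and an edge uv missing x has nexus e = [x ~ u] + [x ~ v]: for e = 2, Γ is
-- complete on {x} ∪ N(x); for e = 1, Γ is complete bipartite between N(x) and the remaining
-- non-isolated vertices, the two sides having equal size by comparing λ at two pairs of edges.
-- Hence L is J(m,2) with m ≥ 4 (m = 3 would make L complete) or a rook graph, and the formula
-- for disjoint edges gives μ = 4, resp. μ = 2.

module Submission where

open import Defs hiding (sym)
open import Data.Nat using (ℕ; zero; suc; _+_; _≤_; z≤n; s≤s; _<ᵇ_)
import Data.Nat.Properties as ℕₚ
open import Data.Bool using (Bool; true; false; _∧_; _∨_; not; _xor_; if_then_else_)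
open import Data.Bool.Properties
  using (∧-conicalˡ; ∧-conicalʳ; ∧-identityʳ; ∨-zeroʳ; ¬-not; not-injective; xor-comm; xor-is-ok; ∧-comm)
import Data.Bool.Properties as Boolₚ
open import Data.Fin using (Fin; zero; suc; _<_)
open import Data.Fin.Properties using (_≟_; any?; suc-injective; injective⇒≤; <-cmp; <-irrefl; <-asym)
open import Data.List using (List; []; _∷_; map; length)
import Data.List.Relation.Unary.All as All
open import Data.List.Relation.Unary.All using ([]; _∷_)
open import Data.List.Relation.Unary.AllPairs using (AllPairs; []; _∷_)
open import Data.List.Relation.Unary.Any using (here; there)
open import Data.List.Relation.Unary.Unique.Propositional using (Unique)
open import Data.List.Membership.Propositional using (_∈_)
open import Data.List.Membership.Propositional.Properties using (∈-++⁺ˡ)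
open import Data.Product using (Σ; ∃; _×_; _,_; proj₁; proj₂)
open import Data.Sum using (_⊎_; inj₁; inj₂; [_,_]′)
open import Data.Empty using (⊥; ⊥-elim)
open import Function using (_∘_; case_of_)
open import Function.Bundles using (_↔_; Inverse; Injection; mk↔ₛ′)
open import Function.Properties.Inverse using (Inverse⇒Injection; ↔-sym; ↔-trans)
open import Relation.Binary.Definitions using (tri<; tri≈; tri>)
open import Relation.Binary.PropositionalEquality
open import Relation.Nullary using (yes; no; ¬_; contradiction)
open import Relation.Nullary.Decidable using (isYes≗does; dec-true; dec-false; _×-dec_)
import Axiom.UniquenessOfIdentityProofs as UIP
open import Algebra.Properties.CommutativeSemigroup ℕₚ.+-commutativeSemigroup using (interchange)

-- Counting Boolean predicates on Fin n

𝟙 : Bool → ℕ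
𝟙 b = if b then 1 else 0

infix 4 _⊆_
_⊆_ : ∀ {n} → (Fin n → Bool) → (Fin n → Bool) → Set
p ⊆ q = ∀ i → p i ≡ true → q i ≡ true

_∖_ : ∀ {n} → (Fin n → Bool) → (Fin n → Bool) → Fin n → Bool
(q ∖ p) i = q i ∧ not (p i)

count-cong : ∀ {n} {p q : Fin n → Bool} → (∀ i → p i ≡ q i) → count p ≡ count q
count-cong {zero}  _ = refl
count-cong {suc n} h = cong₂ _+_ (cong 𝟙 (h zero)) (count-cong (h ∘ suc))

count-none : ∀ {n} {p : Fin n → Bool} → (∀ i → p i ≡ false) → count p ≡ 0
count-none {zero}  _ = refl
count-none {suc n} h rewrite h zero = count-none (h ∘ suc)

count-all : ∀ n → count {n} (λ _ → true) ≡ n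
count-all zero    = refl
count-all (suc n) = cong suc (count-all n)

count-pos : ∀ {n} {p : Fin n → Bool} i → p i ≡ true → 1 ≤ count p
count-pos {suc n} {p} zero    pi rewrite pi = s≤s z≤n
count-pos {suc n} {p} (suc i) pi with p zero
... | true  = s≤s z≤n
... | false = count-pos i pi

count≡0⇒none : ∀ {n} {p : Fin n → Bool} → count p ≡ 0 → ∀ i → p i ≡ false
count≡0⇒none {p = p} c≡0 i = ¬-not λ pi → case subst (1 ≤_) c≡0 (count-pos i pi) of λ ()

count-witness : ∀ {n} {p : Fin n → Bool} → 1 ≤ count p → ∃ λ i → p i ≡ true
count-witness {p = p} 1≤c with any? (λ i → p i Boolₚ.≟ true)
... | yes w  = w
... | no ¬w  = case subst (1 ≤_) (count-none λ i → ¬-not λ pi → ¬w (i , pi)) 1≤c of λ ()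

𝟙-split : ∀ {a b} → (a ≡ true → b ≡ true) → 𝟙 b ≡ 𝟙 a + 𝟙 (b ∧ not a)
𝟙-split {true}  a⇒b rewrite a⇒b refl = refl
𝟙-split {false} {b} _ = cong 𝟙 (sym (∧-identityʳ b))

count-split : ∀ {n} {p q : Fin n → Bool} → p ⊆ q → count q ≡ count p + count (q ∖ p)
count-split {zero}  _   = refl
count-split {suc n} {p} {q} p⊆q =
  trans (cong₂ _+_ (𝟙-split (p⊆q zero)) (count-split (p⊆q ∘ suc)))
        (interchange (𝟙 (p zero)) (𝟙 ((q ∖ p) zero)) _ _)

count-mono : ∀ {n} {p q : Fin n → Bool} → p ⊆ q → count p ≤ count q
count-mono {p = p} p⊆q rewrite count-split p⊆q = ℕₚ.m≤m+n (count p) _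

⊆∧count≥⇒⊇ : ∀ {n} {p q : Fin n → Bool} → p ⊆ q → count q ≤ count p → q ⊆ p
⊆∧count≥⇒⊇ {p = p} {q} p⊆q q≤p i qi = ¬-not λ pi≡false →
  case trans (sym (count≡0⇒none rest≡0 i)) (cong₂ (λ a b → a ∧ not b) qi pi≡false) of λ ()
  where
  rest≡0 : count (q ∖ p) ≡ 0
  rest≡0 = ℕₚ.+-cancelˡ-≡ (count p) _ _ (begin
    count p + count (q ∖ p) ≡⟨ sym (count-split p⊆q) ⟩
    count q                 ≡⟨ ℕₚ.≤-antisym q≤p (count-mono p⊆q) ⟩
    count p                 ≡⟨ sym (ℕₚ.+-identityʳ _) ⟩
    count p + 0             ∎)
    where open ≡-Reasoning

⇔⇒≡ : ∀ {a b : Bool} → (a ≡ true → b ≡ true) → (b ≡ true → a ≡ true) → a ≡ b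
⇔⇒≡ {true}          a⇒b _   = sym (a⇒b refl)
⇔⇒≡ {false} {true}  _   b⇒a = b⇒a refl
⇔⇒≡ {false} {false} _   _   = refl

Bool-≡-irrelevant : {a b : Bool} (p q : a ≡ b) → p ≡ q
Bool-≡-irrelevant = UIP.Decidable⇒UIP.≡-irrelevant Boolₚ._≟_

eqF-refl : ∀ {m} (a : Fin m) → eqF a a ≡ true
eqF-refl a = trans (isYes≗does (a ≟ a)) (dec-true (a ≟ a) refl)

≢⇒eqF-false : ∀ {m} {a b : Fin m} → a ≢ b → eqF a b ≡ false
≢⇒eqF-false {a = a} {b} a≢b = trans (isYes≗does (a ≟ b)) (dec-false (a ≟ b) a≢b)

eqF⇒≡ : ∀ {m} {a b : Fin m} → eqF a b ≡ true → a ≡ b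
eqF⇒≡ {a = a} {b} e with a ≟ b
... | yes a≡b = a≡b

eqF-false⇒≢ : ∀ {m} {a b : Fin m} → eqF a b ≡ false → a ≢ b
eqF-false⇒≢ {a = a} e refl = case trans (sym (eqF-refl a)) e of λ ()

eqF-suc : ∀ {m} (a i : Fin m) → eqF (suc a) (suc i) ≡ eqF a i
eqF-suc a i = ⇔⇒≡ (λ e → subst (λ x → eqF a x ≡ true) (suc-injective (eqF⇒≡ e)) (eqF-refl a))
                  (λ e → subst (λ x → eqF (suc a) (suc x) ≡ true) (eqF⇒≡ e) (eqF-refl (suc a)))

count-singleton : ∀ {n} (a : Fin n) → count (eqF a) ≡ 1
count-singleton {suc n} zero    =
  cong suc (count-none {n} {λ i → eqF zero (suc i)} λ i → ≢⇒eqF-false {a = zero} {suc i} λ ())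
count-singleton {suc n} (suc a) rewrite ≢⇒eqF-false {a = suc a} {zero} (λ ()) =
  trans (count-cong (eqF-suc a)) (count-singleton a)

count-unique : ∀ {n} {p : Fin n → Bool} (a : Fin n) → (∀ i → p i ≡ true → i ≡ a) → p a ≡ true →
  count p ≡ 1
count-unique {p = p} a only pa = trans (count-cong {q = eqF a} pointwise) (count-singleton a)
  where
  pointwise : ∀ i → p i ≡ eqF a i
  pointwise i = ⇔⇒≡ (λ pi → subst (λ x → eqF a x ≡ true) (sym (only i pi)) (eqF-refl a))
                    (λ e → subst (λ x → p x ≡ true) (eqF⇒≡ e) pa)

count-remove : ∀ {n} {p : Fin n → Bool} (a : Fin n) → p a ≡ true → count p ≡ suc (count (p ∖ eqF a))
count-remove {p = p} a pa =
  trans (count-split {p = eqF a} {p} (λ i e → subst (λ x → p x ≡ true) (eqF⇒≡ e) pa))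
        (cong (_+ count (p ∖ eqF a)) (count-singleton a))

count-insert : ∀ {n} (a : Fin n) (q : Fin n → Bool) → q a ≡ false →
  count (λ i → eqF a i ∨ q i) ≡ suc (count q)
count-insert a q qa = trans (count-remove a (cong (_∨ q a) (eqF-refl a))) (cong suc (count-cong {q = q} pointwise))
  where
  pointwise : ∀ i → (eqF a i ∨ q i) ∧ not (eqF a i) ≡ q i
  pointwise i with eqF a i in e
  ... | true  = subst (λ x → false ≡ q x) (eqF⇒≡ e) (sym qa)
  ... | false = ∧-identityʳ (q i)

memberOf : ∀ {n} → List (Fin n) → Fin n → Bool
memberOf []       i = false
memberOf (a ∷ as) i = eqF a i ∨ memberOf as i

∈⇒memberOf : ∀ {n} {x : Fin n} {as} → x ∈ as → memberOf as x ≡ true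
∈⇒memberOf {as = a ∷ as} (here refl) = cong (_∨ memberOf as a) (eqF-refl a)
∈⇒memberOf {as = a ∷ as} (there x∈)  = trans (cong (eqF a _ ∨_) (∈⇒memberOf x∈)) (∨-zeroʳ _)

memberOf⇒∈ : ∀ {n} {x : Fin n} as → memberOf as x ≡ true → x ∈ as
memberOf⇒∈ {x = x} (a ∷ as) m with eqF a x in e
... | true  = here (sym (eqF⇒≡ e))
... | false = there (memberOf⇒∈ as m)

memberOf-∉ : ∀ {n} {a : Fin n} {as} → All.All (a ≢_) as → memberOf as a ≡ false
memberOf-∉ []           = refl
memberOf-∉ (a≢b ∷ a∉)   = cong₂ _∨_ (≢⇒eqF-false (a≢b ∘ sym)) (memberOf-∉ a∉)

count-memberOf : ∀ {n} {as : List (Fin n)} → Unique as → count (memberOf as) ≡ length as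
count-memberOf {n} []      = count-none {n} {λ _ → false} λ _ → refl
count-memberOf {as = a ∷ as} (a∉ ∷ uniq) = trans (count-insert a (memberOf as) (memberOf-∉ a∉))
                                    (cong suc (count-memberOf uniq))

multiplicity : ∀ {n} → List (Fin n → Bool) → Fin n → ℕ
multiplicity []       i = 0
multiplicity (p ∷ ps) i = 𝟙 (p i) + multiplicity ps i

Σcount : ∀ {n} → List (Fin n → Bool) → ℕ
Σcount []       = 0
Σcount (p ∷ ps) = count p + Σcount ps

private
  tails : ∀ {n} → List (Fin (suc n) → Bool) → List (Fin n → Bool)
  tails = map (λ p i → p (suc i))

  Σcount-suc : ∀ {n} (ps : List (Fin (suc n) → Bool)) →
    Σcount ps ≡ multiplicity ps zero + Σcount (tails ps)
  Σcount-suc []       = refl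
  Σcount-suc (p ∷ ps) = trans (cong (count p +_) (Σcount-suc ps)) (interchange (𝟙 (p zero)) _ _ _)

  Σcount-zero : (ps : List (Fin 0 → Bool)) → Σcount ps ≡ 0
  Σcount-zero []       = refl
  Σcount-zero (p ∷ ps) = Σcount-zero ps

  multiplicity-tails : ∀ {n} (ps : List (Fin (suc n) → Bool)) i →
    multiplicity (tails ps) i ≡ multiplicity ps (suc i)
  multiplicity-tails []       i = refl
  multiplicity-tails (p ∷ ps) i = cong (𝟙 (p (suc i)) +_) (multiplicity-tails ps i)

Σcount-cong : ∀ {n} (ps qs : List (Fin n → Bool)) →
  (∀ i → multiplicity ps i ≡ multiplicity qs i) → Σcount ps ≡ Σcount qs
Σcount-cong {zero}  ps qs _ = trans (Σcount-zero ps) (sym (Σcount-zero qs))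
Σcount-cong {suc n} ps qs same = begin
  Σcount ps                                     ≡⟨ Σcount-suc ps ⟩
  multiplicity ps zero + Σcount (tails ps)
    ≡⟨ cong₂ _+_ (same zero) (Σcount-cong (tails ps) (tails qs) same-tails) ⟩
  multiplicity qs zero + Σcount (tails qs)      ≡⟨ sym (Σcount-suc qs) ⟩
  Σcount qs                                     ∎
  where
  open ≡-Reasoning
  same-tails : ∀ i → multiplicity (tails ps) i ≡ multiplicity (tails qs) i
  same-tails i = trans (multiplicity-tails ps i) (trans (same (suc i)) (sym (multiplicity-tails qs i)))

Elements : ∀ {n} → (Fin n → Bool) → Set
Elements {n} p = Σ (Fin n) λ i → p i ≡ true

Elements-≡ : ∀ {n} {p : Fin n → Bool} {s t : Elements p} → proj₁ s ≡ proj₁ t → s ≡ t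
Elements-≡ {s = i , _} {.i , _} refl = cong (i ,_) (Bool-≡-irrelevant _ _)

-- The elements of p in increasing order. The primed helpers take the value of p zero
-- as an argument, so that they can branch on it.
enumerate : ∀ {n} (p : Fin n → Bool) → Fin (count p) → Elements p
enumerate′ : ∀ {n} (p : Fin (suc n) → Bool) b → p zero ≡ b →
  Fin (𝟙 b + count (λ i → p (suc i))) → Elements p
enumerate {zero}  p ()
enumerate {suc n} p = enumerate′ p (p zero) refl
enumerate′ p true  p0 zero    = zero , p0
enumerate′ p true  _  (suc k) = let i , pi = enumerate (λ i → p (suc i)) k in suc i , pi
enumerate′ p false _  k       = let i , pi = enumerate (λ i → p (suc i)) k in suc i , pi

index : ∀ {n} (p : Fin n → Bool) → Elements p → Fin (count p)
index′ : ∀ {n} (p : Fin (suc n) → Bool) b → p zero ≡ b →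
  Elements p → Fin (𝟙 b + count (λ i → p (suc i)))
index {zero}  p (() , _)
index {suc n} p = index′ p (p zero) refl
index′ p true  _  (zero  , _)  = zero
index′ p true  _  (suc i , pi) = suc (index (λ j → p (suc j)) (i , pi))
index′ p false p0 (zero  , pi) = case trans (sym p0) pi of λ ()
index′ p false _  (suc i , pi) = index (λ j → p (suc j)) (i , pi)

index-enumerate : ∀ {n} (p : Fin n → Bool) k → index p (enumerate p k) ≡ k
index-enumerate′ : ∀ {n} (p : Fin (suc n) → Bool) b (p0 : p zero ≡ b) k →
  index′ p b p0 (enumerate′ p b p0 k) ≡ k
index-enumerate {zero}  p ()
index-enumerate {suc n} p = index-enumerate′ p (p zero) refl
index-enumerate′ p true  _ zero    = refl
index-enumerate′ p true  _ (suc k) = cong suc (index-enumerate (λ i → p (suc i)) k)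
index-enumerate′ p false _ k       = index-enumerate (λ i → p (suc i)) k

enumerate-index : ∀ {n} (p : Fin n → Bool) s → enumerate p (index p s) ≡ s
enumerate-index′ : ∀ {n} (p : Fin (suc n) → Bool) b (p0 : p zero ≡ b) s →
  enumerate′ p b p0 (index′ p b p0 s) ≡ s
enumerate-index {zero}  p (() , _)
enumerate-index {suc n} p = enumerate-index′ p (p zero) refl
enumerate-index′ p true  _  (zero  , _)  = Elements-≡ refl
enumerate-index′ p true  _  (suc i , pi) =
  Elements-≡ (cong (suc ∘ proj₁) (enumerate-index (λ j → p (suc j)) (i , pi)))
enumerate-index′ p false p0 (zero  , pi) = case trans (sym p0) pi of λ ()
enumerate-index′ p false _  (suc i , pi) =
  Elements-≡ (cong (suc ∘ proj₁) (enumerate-index (λ j → p (suc j)) (i , pi)))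

enumerate-mono : ∀ {n} (p : Fin n → Bool) {k l : Fin (count p)} →
  k < l → proj₁ (enumerate p k) < proj₁ (enumerate p l)
enumerate-mono′ : ∀ {n} (p : Fin (suc n) → Bool) b (p0 : p zero ≡ b) {k l} →
  k < l → proj₁ (enumerate′ p b p0 k) < proj₁ (enumerate′ p b p0 l)
enumerate-mono {zero}  p {()}
enumerate-mono {suc n} p = enumerate-mono′ p (p zero) refl
enumerate-mono′ p true  _ {zero}  {suc l} _         = s≤s z≤n
enumerate-mono′ p true  _ {suc k} {suc l} (s≤s k<l) = s≤s (enumerate-mono (λ i → p (suc i)) k<l)
enumerate-mono′ p false _ k<l                       = s≤s (enumerate-mono (λ i → p (suc i)) k<l)

index-injective : ∀ {n} (p : Fin n → Bool) {s t : Elements p} → index p s ≡ index p t → s ≡ t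
index-injective p {s} {t} eq =
  trans (sym (enumerate-index p s)) (trans (cong (enumerate p) eq) (enumerate-index p t))

index-cong : ∀ {n} (p : Fin n → Bool) {s t : Elements p} → proj₁ s ≡ proj₁ t → index p s ≡ index p t
index-cong p eq = cong (index p) (Elements-≡ eq)

index-mono : ∀ {n} (p : Fin n → Bool) (s t : Elements p) → proj₁ s < proj₁ t → index p s < index p t
index-mono p s t s<t with <-cmp (index p s) (index p t)
... | tri< lt _ _ = lt
... | tri≈ _ eq _ = contradiction s<t (<-irrefl (cong proj₁ (index-injective p eq)))
... | tri> _ _ gt = contradiction (subst₂ _<_ (cong proj₁ (enumerate-index p t))
                                                (cong proj₁ (enumerate-index p s)) (enumerate-mono p gt))
                                  (<-asym s<t)

eqF-index : ∀ {n} (p : Fin n → Bool) (s t : Elements p) → eqF (index p s) (index p t) ≡ eqF (proj₁ s) (proj₁ t)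
eqF-index p s t = ⇔⇒≡ (λ e → subst (λ x → eqF (proj₁ s) x ≡ true) (cong proj₁ (index-injective p (eqF⇒≡ e)))
                                    (eqF-refl (proj₁ s)))
                      (λ e → subst (λ x → eqF (index p s) x ≡ true) (index-cong p (eqF⇒≡ e)) (eqF-refl _))

count-≤-by-injection : ∀ {n m} (p : Fin n → Bool) (q : Fin m → Bool) (f : Elements p → Elements q)
  (g : Elements q → Elements p) → (∀ s → proj₁ (g (f s)) ≡ proj₁ s) → count p ≤ count q
count-≤-by-injection p q f g gf = injective⇒≤ {f = φ} φ-injective
  where
  φ : Fin (count p) → Fin (count q)
  φ k = index q (f (enumerate p k))
  retract : ∀ k → index p (g (enumerate q (φ k))) ≡ k
  retract k rewrite enumerate-index q (f (enumerate p k)) | Elements-≡ {s = g (f (enumerate p k))} (gf (enumerate p k)) =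
    index-enumerate p k
  φ-injective : ∀ {k l} → φ k ≡ φ l → k ≡ l
  φ-injective {k} {l} eq = trans (sym (retract k)) (trans (cong (λ x → index p (g (enumerate q x))) eq) (retract l))

count-≡-by-bijection : ∀ {n m} (p : Fin n → Bool) (q : Fin m → Bool) (f : Elements p → Elements q)
  (g : Elements q → Elements p) → (∀ s → proj₁ (g (f s)) ≡ proj₁ s) → (∀ t → proj₁ (f (g t)) ≡ proj₁ t) →
  count p ≡ count q
count-≡-by-bijection p q f g gf fg =
  ℕₚ.≤-antisym (count-≤-by-injection p q f g gf) (count-≤-by-injection q p g f fg)

-- Regular graphs and their cliques

module _ (G : Graph) where

  private
    adj-sym : ∀ {u v} → adj G u v ≡ true → adj G v u ≡ true
    adj-sym {u} {v} a = trans (Graph.sym G v u) a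

  others : Fin (n G) → Fin (n G) → Bool
  others u v = not (eqF u v)

  count-others : ∀ u → suc (count (others u)) ≡ n G
  count-others u = trans (sym (count-remove {p = λ _ → true} u refl)) (count-all (n G))

  adj⊆others : ∀ u → adj G u ⊆ others u
  adj⊆others u v a = cong not (≢⇒eqF-false λ { refl → case trans (sym a) (irrefl G u) of λ () })

  -- u has degree n - 1, hence so does every vertex.
  regular-dominating⇒complete : ∀ {k} u → IsRegular G k → (∀ v → u ≢ v → adj G u v ≡ true) → IsComplete G
  regular-dominating⇒complete {k} u regular dominating w v w≢v =
    ⊆∧count≥⇒⊇ (adj⊆others w) |others|≤deg v (cong not (≢⇒eqF-false w≢v))
    where
    |others|≤deg : count (others w) ≤ degree G w
    |others|≤deg = begin
      count (others w) ≡⟨ ℕₚ.suc-injective (trans (count-others w) (sym (count-others u))) ⟩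
      count (others u) ≤⟨ count-mono (λ v u≠v → dominating v (eqF-false⇒≢ (not-injective u≠v))) ⟩
      degree G u       ≡⟨ trans (regular u) (sym (regular w)) ⟩
      degree G w       ∎
      where
      open ℕₚ.≤-Reasoning

  regularClique-size≥2 : ∀ {k C} → IsRegular G k → ¬ IsComplete G → IsRegularClique G C → 2 ≤ count C
  regularClique-size≥2 {k} {C} regular ¬complete (_ , e , 1≤e , nexus) = size (count C) refl
    where
    1≤nexus : ∀ v → C v ≡ false → 1 ≤ count (λ w → C w ∧ adj G v w)
    1≤nexus v Cv = subst (1 ≤_) (sym (nexus v Cv)) 1≤e

    size : ∀ m → count C ≡ m → 2 ≤ m
    size (suc (suc _)) _ = s≤s (s≤s z≤n)
    size zero |C|≡0 = contradiction (λ u _ _ → ⊥-elim (no-vertex u)) ¬complete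
      where
      no-vertex : Fin (n G) → ⊥
      no-vertex u = case ℕₚ.≤-trans (1≤nexus u (count≡0⇒none |C|≡0 u)) nexus≤|C| of λ ()
        where
        nexus≤|C| : count (λ w → C w ∧ adj G u w) ≤ 0
        nexus≤|C| = ℕₚ.≤-trans (count-mono {q = C} (λ w → ∧-conicalˡ _ _)) (ℕₚ.≤-reflexive |C|≡0)
    size (suc zero) |C|≡1 = singleton (count-witness {p = C} (subst (1 ≤_) (sym |C|≡1) (s≤s z≤n)))
      where
      singleton : (∃ λ c → C c ≡ true) → 2 ≤ 1
      singleton (c , Cc) = contradiction (regular-dominating⇒complete c regular dominating) ¬complete
        where
        only-c : ∀ w → C w ≡ true → c ≡ w
        only-c w Cw = eqF⇒≡ (not-injective (trans (cong (_∧ not (eqF c w)) (sym Cw))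
          (count≡0⇒none {p = C ∖ eqF c} (ℕₚ.suc-injective (trans (sym (count-remove c Cc)) |C|≡1)) w)))
        dominating : ∀ v → c ≢ v → adj G c v ≡ true
        dominating v c≢v with count-witness {p = λ w → C w ∧ adj G v w} (1≤nexus v (¬-not (c≢v ∘ only-c v)))
        ... | w , w∈ = adj-sym (subst (λ x → adj G v x ≡ true) (sym (only-c w (∧-conicalˡ _ _ w∈))) (∧-conicalʳ _ _ w∈))

  Pairwise-adjacent : List (Fin (n G)) → Set
  Pairwise-adjacent = AllPairs (λ x y → adj G x y ≡ true)

  pairwise-adjacent⇒adj : ∀ {xs x y} → Pairwise-adjacent xs → x ∈ xs → y ∈ xs → x ≢ y → adj G x y ≡ true
  pairwise-adjacent⇒adj (_   ∷ _)  (here refl) (here refl) x≢y = contradiction refl x≢y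
  pairwise-adjacent⇒adj (x~ ∷ _)  (here refl) (there y∈)  _   = All.lookup x~ y∈
  pairwise-adjacent⇒adj (y~ ∷ _)  (there x∈)  (here refl) _   = adj-sym (All.lookup y~ x∈)
  pairwise-adjacent⇒adj (_  ∷ xs~) (there x∈) (there y∈)  x≢y = pairwise-adjacent⇒adj xs~ x∈ y∈ x≢y

  clique-closed : ∀ {xs x} → Unique xs → Pairwise-adjacent xs → x ∈ xs → suc (degree G x) ≤ length xs →
    ∀ y → adj G x y ≡ true → memberOf xs y ≡ true
  clique-closed {xs} {x} uniq xs~ x∈ deg<|xs| y xy =
    ∧-conicalˡ _ _ (⊆∧count≥⇒⊇ clique-nbrs |nbrs|≤deg y xy)
    where
    clique-nbrs : memberOf xs ∖ eqF x ⊆ adj G x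
    clique-nbrs z z∈ = pairwise-adjacent⇒adj xs~ x∈ (memberOf⇒∈ xs (∧-conicalˡ _ _ z∈))
                                             (eqF-false⇒≢ (not-injective (∧-conicalʳ _ _ z∈)))
    |nbrs|≤deg : degree G x ≤ count (memberOf xs ∖ eqF x)
    |nbrs|≤deg = ℕₚ.≤-pred (ℕₚ.≤-trans deg<|xs|
      (ℕₚ.≤-reflexive (trans (sym (count-memberOf uniq)) (count-remove x (∈⇒memberOf x∈)))))

  adjacent-to-all⇒⊆ : ∀ {x ys} → All.All (λ y → adj G x y ≡ true) ys → memberOf ys ⊆ adj G x
  adjacent-to-all⇒⊆ {ys = ys} x~ys y y∈ = All.lookup x~ys (memberOf⇒∈ ys y∈)

  two-neighbours⇒2≤degree : ∀ {u a b} → adj G u a ≡ true → adj G u b ≡ true → a ≢ b → 2 ≤ degree G u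
  two-neighbours⇒2≤degree ua ub a≢b =
    ℕₚ.≤-trans (ℕₚ.≤-reflexive (sym (count-memberOf ((a≢b ∷ []) ∷ [] ∷ []))))
               (count-mono (adjacent-to-all⇒⊆ (ua ∷ ub ∷ [])))

-- Edges of Γ and adjacency in L(Γ)

-- Truth table of lineAdj for edges {a,b} and {c,d} in terms of w = [a=c], x = [a=d], y = [b=c], z = [b=d];
-- the hypotheses exclude the combinations impossible for edges with a < b and c < d.
lineAdj-truthTable : ∀ w x y z → (w ≡ true → y ≡ true → ⊥) → (x ≡ true → y ≡ true → ⊥) →
  (x ≡ true → z ≡ true → ⊥) → (w ≡ true → x ≡ true → ⊥) → (y ≡ true → z ≡ true → ⊥) →
  not (w ∧ z) ∧ (w ∨ x ∨ y ∨ z) ≡ (w ∨ x) xor (y ∨ z)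
lineAdj-truthTable true  true  y     z     _ _ _ wx _ = ⊥-elim (wx refl refl)
lineAdj-truthTable true  false true  z     wy _ _ _ _ = ⊥-elim (wy refl refl)
lineAdj-truthTable true  false false true  _ _ _ _ _ = refl
lineAdj-truthTable true  false false false _ _ _ _ _ = refl
lineAdj-truthTable false true  true  z     _ xy _ _ _ = ⊥-elim (xy refl refl)
lineAdj-truthTable false true  false true  _ _ xz _ _ = ⊥-elim (xz refl refl)
lineAdj-truthTable false true  false false _ _ _ _ _ = refl
lineAdj-truthTable false false true  true  _ _ _ _ yz = ⊥-elim (yz refl refl)
lineAdj-truthTable false false true  false _ _ _ _ _ = refl
lineAdj-truthTable false false false true  _ _ _ _ _ = refl
lineAdj-truthTable false false false false _ _ _ _ _ = refl

module EdgesOf (Γ : Graph) where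

  V : Set
  V = Fin (n Γ)

  E : Set
  E = Edge Γ

  end₁ end₂ : E → V
  end₁ g = proj₁ (proj₁ g)
  end₂ g = proj₂ (proj₁ g)

  end₁≢end₂ : ∀ g → end₁ g ≢ end₂ g
  end₁≢end₂ g eq = <-irrefl eq (proj₁ (proj₂ g))

  -- Opaque, so that v and g can be inferred from v ∈ₑ g.
  infix 7 _∈ₑ_
  opaque
    _∈ₑ_ : V → E → Bool
    v ∈ₑ g = eqF v (end₁ g) ∨ eqF v (end₂ g)

  opaque
    unfolding _∈ₑ_

    end₁-∈ₑ : ∀ g → end₁ g ∈ₑ g ≡ true
    end₁-∈ₑ g = cong (_∨ eqF (end₁ g) (end₂ g)) (eqF-refl (end₁ g))

    end₂-∈ₑ : ∀ g → end₂ g ∈ₑ g ≡ true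
    end₂-∈ₑ g = trans (cong (eqF (end₂ g) (end₁ g) ∨_) (eqF-refl (end₂ g))) (∨-zeroʳ _)

    ∈ₑ⇒end : ∀ {v g} → v ∈ₑ g ≡ true → v ≡ end₁ g ⊎ v ≡ end₂ g
    ∈ₑ⇒end {v} {g} v∈g with eqF v (end₁ g) in e
    ... | true  = inj₁ (eqF⇒≡ e)
    ... | false = inj₂ (eqF⇒≡ v∈g)

  adj-ends : ∀ g → adj Γ (end₁ g) (end₂ g) ≡ true
  adj-ends g = proj₂ (proj₂ g)

  adj-sym : ∀ {u v} → adj Γ u v ≡ true → adj Γ v u ≡ true
  adj-sym {u} {v} a = trans (Graph.sym Γ v u) a

  adj⇒≢ : ∀ {u v} → adj Γ u v ≡ true → u ≢ v
  adj⇒≢ {u} a refl = case trans (sym a) (irrefl Γ u) of λ ()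

  edge-≡ : ∀ {g h} → end₁ g ≡ end₁ h → end₂ g ≡ end₂ h → g ≡ h
  edge-≡ {(_ , l , p)} {(_ , l′ , p′)} refl refl
    rewrite ℕₚ.≤-irrelevant l l′ | Bool-≡-irrelevant p p′ = refl

  ∈ₑ-ends : ∀ {u v g} → u ∈ₑ g ≡ true → v ∈ₑ g ≡ true → u ≢ v →
    (end₁ g ≡ u × end₂ g ≡ v) ⊎ (end₁ g ≡ v × end₂ g ≡ u)
  ∈ₑ-ends u∈g v∈g u≢v with ∈ₑ⇒end u∈g | ∈ₑ⇒end v∈g
  ... | inj₁ u₁ | inj₁ v₁ = contradiction (trans u₁ (sym v₁)) u≢v
  ... | inj₁ u₁ | inj₂ v₂ = inj₁ (sym u₁ , sym v₂)
  ... | inj₂ u₂ | inj₁ v₁ = inj₂ (sym v₁ , sym u₂)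
  ... | inj₂ u₂ | inj₂ v₂ = contradiction (trans u₂ (sym v₂)) u≢v

  edge-determined : ∀ {u v g h} → u ∈ₑ g ≡ true → v ∈ₑ g ≡ true → u ∈ₑ h ≡ true → v ∈ₑ h ≡ true →
    u ≢ v → g ≡ h
  edge-determined {g = g} {h} u∈g v∈g u∈h v∈h u≢v
    with ∈ₑ-ends u∈g v∈g u≢v | ∈ₑ-ends u∈h v∈h u≢v
  ... | inj₁ (g₁ , g₂) | inj₁ (h₁ , h₂) = edge-≡ (trans g₁ (sym h₁)) (trans g₂ (sym h₂))
  ... | inj₂ (g₁ , g₂) | inj₂ (h₁ , h₂) = edge-≡ (trans g₁ (sym h₁)) (trans g₂ (sym h₂))
  ... | inj₁ (g₁ , g₂) | inj₂ (h₁ , h₂) =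
    contradiction (subst₂ _<_ h₁ h₂ (proj₁ (proj₂ h))) (<-asym (subst₂ _<_ g₁ g₂ (proj₁ (proj₂ g))))
  ... | inj₂ (g₁ , g₂) | inj₁ (h₁ , h₂) =
    contradiction (subst₂ _<_ g₁ g₂ (proj₁ (proj₂ g))) (<-asym (subst₂ _<_ h₁ h₂ (proj₁ (proj₂ h))))

  two-ends : ∀ {u v w g} → u ∈ₑ g ≡ true → v ∈ₑ g ≡ true → w ∈ₑ g ≡ true → u ≡ v ⊎ u ≡ w ⊎ v ≡ w
  two-ends u∈g v∈g w∈g with ∈ₑ⇒end u∈g | ∈ₑ⇒end v∈g | ∈ₑ⇒end w∈g
  ... | inj₁ u₁ | inj₁ v₁ | _       = inj₁ (trans u₁ (sym v₁))
  ... | inj₂ u₂ | inj₂ v₂ | _       = inj₁ (trans u₂ (sym v₂))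
  ... | inj₁ u₁ | inj₂ _  | inj₁ w₁ = inj₂ (inj₁ (trans u₁ (sym w₁)))
  ... | inj₁ _  | inj₂ v₂ | inj₂ w₂ = inj₂ (inj₂ (trans v₂ (sym w₂)))
  ... | inj₂ _  | inj₁ v₁ | inj₁ w₁ = inj₂ (inj₂ (trans v₁ (sym w₁)))
  ... | inj₂ u₂ | inj₁ _  | inj₂ w₂ = inj₂ (inj₁ (trans u₂ (sym w₂)))

  third-∉ₑ : ∀ {u v w} g → u ≢ v → u ≢ w → v ≢ w → u ∈ₑ g ≡ true → v ∈ₑ g ≡ true → w ∈ₑ g ≡ false
  third-∉ₑ {u} {v} {w} g u≢v u≢w v≢w u∈g v∈g = ¬-not λ w∈g → case two-ends u∈g v∈g w∈g of λ where
    (inj₁ u≡v)        → u≢v u≡v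
    (inj₂ (inj₁ u≡w)) → u≢w u≡w
    (inj₂ (inj₂ v≡w)) → v≢w v≡w

  ∈ₑ∧∉ₑ⇒≢ : ∀ {u v g} → u ∈ₑ g ≡ true → v ∈ₑ g ≡ false → u ≢ v
  ∈ₑ∧∉ₑ⇒≢ u∈g v∉g refl = case trans (sym u∈g) v∉g of λ ()

  ∈ₑ∧∉ₑ⇒edge≢ : ∀ {v g h} → v ∈ₑ g ≡ true → v ∈ₑ h ≡ false → g ≢ h
  ∈ₑ∧∉ₑ⇒edge≢ v∈g v∉h refl = case trans (sym v∈g) v∉h of λ ()

  ∈ₑ⇒adj : ∀ {u v g} → u ∈ₑ g ≡ true → v ∈ₑ g ≡ true → u ≢ v → adj Γ u v ≡ true
  ∈ₑ⇒adj {g = g} u∈g v∈g u≢v with ∈ₑ-ends u∈g v∈g u≢v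
  ... | inj₁ (refl , refl) = adj-ends g
  ... | inj₂ (refl , refl) = adj-sym (adj-ends g)

  opaque
    edge : ∀ u v → adj Γ u v ≡ true → E
    edge u v a with <-cmp u v
    ... | tri< u<v _ _ = (u , v) , u<v , a
    ... | tri≈ _ u≡v _ = contradiction u≡v (adj⇒≢ a)
    ... | tri> _ _ v<u = (v , u) , v<u , adj-sym a

  opaque
    unfolding edge

    ∈ₑ-edge₁ : ∀ u v a → u ∈ₑ edge u v a ≡ true
    ∈ₑ-edge₁ u v a with <-cmp u v
    ... | tri< u<v _ _ = end₁-∈ₑ ((u , v) , u<v , a)
    ... | tri≈ _ u≡v _ = contradiction u≡v (adj⇒≢ a)
    ... | tri> _ _ v<u = end₂-∈ₑ ((v , u) , v<u , adj-sym a)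

    ∈ₑ-edge₂ : ∀ u v a → v ∈ₑ edge u v a ≡ true
    ∈ₑ-edge₂ u v a with <-cmp u v
    ... | tri< u<v _ _ = end₂-∈ₑ ((u , v) , u<v , a)
    ... | tri≈ _ u≡v _ = contradiction u≡v (adj⇒≢ a)
    ... | tri> _ _ v<u = end₁-∈ₑ ((v , u) , v<u , adj-sym a)

  other : V → E → V
  other u g = if eqF u (end₁ g) then end₂ g else end₁ g

  other-∈ₑ : ∀ u g → other u g ∈ₑ g ≡ true
  other-∈ₑ u g with eqF u (end₁ g)
  ... | true  = end₂-∈ₑ g
  ... | false = end₁-∈ₑ g

  other-≢ : ∀ u g → u ∈ₑ g ≡ true → u ≢ other u g
  other-≢ u g u∈g with eqF u (end₁ g) in e
  ... | true  = λ u≡ → end₁≢end₂ g (trans (sym (eqF⇒≡ e)) u≡)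
  ... | false = eqF-false⇒≢ e

  other-unique : ∀ {u v g} → u ∈ₑ g ≡ true → v ∈ₑ g ≡ true → u ≢ v → other u g ≡ v
  other-unique {u} {v} {g} u∈g v∈g u≢v with ∈ₑ-ends u∈g v∈g u≢v
  ... | inj₁ (refl , refl) rewrite eqF-refl (end₁ g) = refl
  ... | inj₂ (refl , refl) rewrite ≢⇒eqF-false (end₁≢end₂ g ∘ sym) = refl

  opaque
    unfolding _∈ₑ_

    lineAdj-ends-xor : ∀ g h → lineAdj Γ g h ≡ end₁ g ∈ₑ h xor end₂ g ∈ₑ h
    lineAdj-ends-xor g h = lineAdj-truthTable (eqF a c) (eqF a d) (eqF b c) (eqF b d)
      (λ ac bc → end₁≢end₂ g (trans (eqF⇒≡ ac) (sym (eqF⇒≡ bc))))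
      (λ ad bc → <-asym (proj₁ (proj₂ g)) (subst₂ _<_ (sym (eqF⇒≡ bc)) (sym (eqF⇒≡ ad)) (proj₁ (proj₂ h))))
      (λ ad bd → end₁≢end₂ g (trans (eqF⇒≡ ad) (sym (eqF⇒≡ bd))))
      (λ ac ad → end₁≢end₂ h (trans (sym (eqF⇒≡ ac)) (eqF⇒≡ ad)))
      (λ bc bd → end₁≢end₂ h (trans (sym (eqF⇒≡ bc)) (eqF⇒≡ bd)))
      where
      a b c d : V
      a = end₁ g ; b = end₂ g ; c = end₁ h ; d = end₂ h

  lineAdj-xor : ∀ {u v g} → u ∈ₑ g ≡ true → v ∈ₑ g ≡ true → u ≢ v →
    ∀ h → lineAdj Γ g h ≡ u ∈ₑ h xor v ∈ₑ h
  lineAdj-xor {g = g} u∈g v∈g u≢v h with ∈ₑ-ends u∈g v∈g u≢v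
  ... | inj₁ (refl , refl) = lineAdj-ends-xor g h
  ... | inj₂ (refl , refl) = trans (lineAdj-ends-xor g h) (xor-comm (end₁ g ∈ₑ h) _)

  lineAdj-false⇒∉ₑ : ∀ {u v g h} → lineAdj Γ g h ≡ false → g ≢ h →
    u ∈ₑ g ≡ true → v ∈ₑ g ≡ true → u ≢ v → u ∈ₑ h ≡ false × v ∈ₑ h ≡ false
  lineAdj-false⇒∉ₑ {u} {v} {g} {h} ¬gh g≢h u∈g v∈g u≢v
    with u ∈ₑ h in u∈h | v ∈ₑ h in v∈h | trans (sym (lineAdj-xor u∈g v∈g u≢v h)) ¬gh
  ... | false | false | _ = refl , refl
  ... | true  | true  | _ = contradiction (edge-determined u∈g v∈g u∈h v∈h u≢v) g≢h

  nonadjacent⇒disjoint : ∀ {u v g h} → lineAdj Γ g h ≡ false → g ≢ h →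
    u ∈ₑ g ≡ true → v ∈ₑ h ≡ true → u ≢ v
  nonadjacent⇒disjoint {u} {g = g} ¬gh g≢h u∈g v∈h u≡v =
    ∈ₑ∧∉ₑ⇒≢ v∈h (proj₁ (lineAdj-false⇒∉ₑ ¬gh g≢h u∈g (other-∈ₑ u g) (other-≢ u g u∈g))) (sym u≡v)

  ∈ₑ-third-end : ∀ {u v w g} → u ∈ₑ g ≡ true → v ∈ₑ g ≡ true → w ∈ₑ g ≡ true → u ≢ v → u ≢ w → v ≡ w
  ∈ₑ-third-end u∈g v∈g w∈g u≢v u≢w with two-ends u∈g v∈g w∈g
  ... | inj₁ u≡v        = contradiction u≡v u≢v
  ... | inj₂ (inj₁ u≡w) = contradiction u≡w u≢w
  ... | inj₂ (inj₂ v≡w) = v≡w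

  common-end⇒lineAdj : ∀ {x g h} → x ∈ₑ g ≡ true → x ∈ₑ h ≡ true → g ≢ h → lineAdj Γ g h ≡ true
  common-end⇒lineAdj {x} {g} {h} x∈g x∈h g≢h =
    trans (lineAdj-xor x∈g (other-∈ₑ x g) (other-≢ x g x∈g) h) (cong₂ _xor_ x∈h far-end∉h)
    where
    far-end∉h : other x g ∈ₑ h ≡ false
    far-end∉h = ¬-not λ y∈h → g≢h (edge-determined x∈g (other-∈ₑ x g) x∈h y∈h (other-≢ x g x∈g))

-- Counting in the line graph

-- Pointwise identities for Σcount-cong; the trailing + 0 comes from the list encoding of multiplicity.
private
  𝟙-xor : ∀ a b → 𝟙 (a xor b) + (𝟙 (a ∧ b) + (𝟙 (a ∧ b) + 0)) ≡ 𝟙 a + (𝟙 b + 0)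
  𝟙-xor true  true  = refl
  𝟙-xor true  false = refl
  𝟙-xor false true  = refl
  𝟙-xor false false = refl

  𝟙-∧-xor : ∀ a b c → (a ≡ true → b ≡ true → c ≡ false) →
    𝟙 (a ∧ (b xor c)) + 0 ≡ 𝟙 (a ∧ b) + (𝟙 (a ∧ c) + 0)
  𝟙-∧-xor true  true  true  ab⇒¬c = case ab⇒¬c refl refl of λ ()
  𝟙-∧-xor true  true  false _ = refl
  𝟙-∧-xor true  false true  _ = refl
  𝟙-∧-xor true  false false _ = refl
  𝟙-∧-xor false b     c     _ = refl

  𝟙-xor-xor : ∀ a b c → (a ≡ true → b ≡ true → c ≡ false) →
    𝟙 ((a xor b) ∧ (a xor c)) + (𝟙 (a ∧ b) + (𝟙 (a ∧ c) + 0)) ≡ 𝟙 a + (𝟙 (b ∧ c) + 0)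
  𝟙-xor-xor true  true  true  ab⇒¬c = case ab⇒¬c refl refl of λ ()
  𝟙-xor-xor true  true  false _ = refl
  𝟙-xor-xor true  false true  _ = refl
  𝟙-xor-xor true  false false _ = refl
  𝟙-xor-xor false true  true  _ = refl
  𝟙-xor-xor false true  false _ = refl
  𝟙-xor-xor false false true  _ = refl
  𝟙-xor-xor false false false _ = refl

  𝟙-xor∧xor : ∀ a b c d → (a ≡ true → b ≡ true → c ≡ false) → (a ≡ true → b ≡ true → d ≡ false) →
    (a ≡ true → c ≡ true → d ≡ false) → (b ≡ true → c ≡ true → d ≡ false) →
    𝟙 ((a xor b) ∧ (c xor d)) + 0 ≡ 𝟙 (a ∧ c) + (𝟙 (a ∧ d) + (𝟙 (b ∧ c) + (𝟙 (b ∧ d) + 0)))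
  𝟙-xor∧xor true  true  true  _     abc _   _   _   = case abc refl refl of λ ()
  𝟙-xor∧xor true  true  false true  _   abd _   _   = case abd refl refl of λ ()
  𝟙-xor∧xor true  false true  true  _   _   acd _   = case acd refl refl of λ ()
  𝟙-xor∧xor false true  true  true  _   _   _   bcd = case bcd refl refl of λ ()
  𝟙-xor∧xor true  true  false false _ _ _ _ = refl
  𝟙-xor∧xor true  false true  false _ _ _ _ = refl
  𝟙-xor∧xor true  false false true  _ _ _ _ = refl
  𝟙-xor∧xor true  false false false _ _ _ _ = refl
  𝟙-xor∧xor false true  true  false _ _ _ _ = refl
  𝟙-xor∧xor false true  false true  _ _ _ _ = refl
  𝟙-xor∧xor false true  false false _ _ _ _ = refl
  𝟙-xor∧xor false false true  true  _ _ _ _ = refl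
  𝟙-xor∧xor false false true  false _ _ _ _ = refl
  𝟙-xor∧xor false false false true  _ _ _ _ = refl
  𝟙-xor∧xor false false false false _ _ _ _ = refl

module LineCounts (Γ : Graph) {m : ℕ} (enum : Fin m ↔ Edge Γ) where
  open EdgesOf Γ
  open Inverse enum using (to; from; strictlyInverseˡ; strictlyInverseʳ)

  countE : (E → Bool) → ℕ
  countE P = count (P ∘ to)

  countE-cong : ∀ {P Q} → (∀ g → P g ≡ Q g) → countE P ≡ countE Q
  countE-cong P≗Q = count-cong (λ i → P≗Q (to i))

  countE-∈ₑ : ∀ u → countE (u ∈ₑ_) ≡ degree Γ u
  countE-∈ₑ u = count-≡-by-bijection (λ i → u ∈ₑ to i) (adj Γ u) far back back-far far-back
    where
    far : Elements (λ i → u ∈ₑ to i) → Elements (adj Γ u)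
    far (i , u∈) = other u (to i) , ∈ₑ⇒adj u∈ (other-∈ₑ u (to i)) (other-≢ u (to i) u∈)
    back : Elements (adj Γ u) → Elements (λ i → u ∈ₑ to i)
    back (v , a) = from (edge u v a) , subst (λ g → u ∈ₑ g ≡ true) (sym (strictlyInverseˡ _)) (∈ₑ-edge₁ u v a)
    back-far : ∀ s → proj₁ (back (far s)) ≡ proj₁ s
    back-far (i , u∈) = trans (cong from (edge-determined (∈ₑ-edge₁ u v a) (∈ₑ-edge₂ u v a) u∈ (other-∈ₑ u (to i))
                                                         (other-≢ u (to i) u∈)))
                              (strictlyInverseʳ i)
      where v = proj₁ (far (i , u∈)) ; a = proj₂ (far (i , u∈))
    far-back : ∀ t → proj₁ (far (back t)) ≡ proj₁ t
    far-back (v , a) = trans (cong (other u) (strictlyInverseˡ _))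
                             (other-unique (∈ₑ-edge₁ u v a) (∈ₑ-edge₂ u v a) (adj⇒≢ a))

  countE-both-∈ₑ : ∀ u v → u ≢ v → countE (λ h → u ∈ₑ h ∧ v ∈ₑ h) ≡ 𝟙 (adj Γ u v)
  countE-both-∈ₑ u v u≢v with adj Γ u v in a
  ... | true  = count-unique (from (edge u v a)) on-edge (subst (λ g → u ∈ₑ g ∧ v ∈ₑ g ≡ true)
                  (sym (strictlyInverseˡ _)) (cong₂ _∧_ (∈ₑ-edge₁ u v a) (∈ₑ-edge₂ u v a)))
    where
    on-edge : ∀ i → u ∈ₑ to i ∧ v ∈ₑ to i ≡ true → i ≡ from (edge u v a)
    on-edge i uv∈ = trans (sym (strictlyInverseʳ i)) (cong from
      (edge-determined (∧-conicalˡ _ _ uv∈) (∧-conicalʳ _ _ uv∈) (∈ₑ-edge₁ u v a) (∈ₑ-edge₂ u v a) u≢v))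
  ... | false = count-none {p = λ i → u ∈ₑ to i ∧ v ∈ₑ to i} λ i → ¬-not λ uv∈ →
    case trans (sym (∈ₑ⇒adj (∧-conicalˡ _ _ uv∈) (∧-conicalʳ _ _ uv∈) u≢v)) a of λ ()

  private
    countE-edge-both-∈ₑ : ∀ {u v g} → u ∈ₑ g ≡ true → v ∈ₑ g ≡ true → u ≢ v →
      countE (λ h → u ∈ₑ h ∧ v ∈ₑ h) ≡ 1
    countE-edge-both-∈ₑ u∈g v∈g u≢v = trans (countE-both-∈ₑ _ _ u≢v) (cong 𝟙 (∈ₑ⇒adj u∈g v∈g u≢v))

  lineDegree : E → ℕ
  lineDegree g = countE (lineAdj Γ g)

  lineCommon : E → E → ℕ
  lineCommon g h = countE (λ x → lineAdj Γ g x ∧ lineAdj Γ h x)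

  lineDegree-ends : ∀ {u v g} → u ∈ₑ g ≡ true → v ∈ₑ g ≡ true → u ≢ v →
    lineDegree g + 2 ≡ degree Γ u + degree Γ v
  lineDegree-ends {u} {v} {g} u∈g v∈g u≢v = begin
    lineDegree g + 2                              ≡⟨ cong (_+ 2) (countE-cong (lineAdj-xor u∈g v∈g u≢v)) ⟩
    countE uv-xor + (1 + (1 + 0))                   ≡⟨ cong (λ c → countE uv-xor + (c + (c + 0))) (sym uv-one) ⟩
    countE uv-xor + (countE uv-both + (countE uv-both + 0))
                                                    ≡⟨ Σcount-cong (_ ∷ _ ∷ _ ∷ []) (_ ∷ _ ∷ [])
                                                         (λ i → 𝟙-xor (u ∈ₑ to i) (v ∈ₑ to i)) ⟩
    countE (u ∈ₑ_) + (countE (v ∈ₑ_) + 0)           ≡⟨ cong₂ _+_ (countE-∈ₑ u)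
                                                         (trans (ℕₚ.+-identityʳ _) (countE-∈ₑ v)) ⟩
    degree Γ u + degree Γ v                         ∎
    where
    open ≡-Reasoning
    uv-xor uv-both : E → Bool
    uv-xor h = u ∈ₑ h xor v ∈ₑ h
    uv-both h = u ∈ₑ h ∧ v ∈ₑ h
    uv-one : countE uv-both ≡ 1
    uv-one = countE-edge-both-∈ₑ u∈g v∈g u≢v

  lineCommon-meeting : ∀ {a b c g h} → a ∈ₑ g ≡ true → b ∈ₑ g ≡ true → a ∈ₑ h ≡ true → c ∈ₑ h ≡ true →
    a ≢ b → a ≢ c → b ≢ c → lineCommon g h + 2 ≡ degree Γ a + 𝟙 (adj Γ b c)
  lineCommon-meeting {a} {b} {c} {g} {h} a∈g b∈g a∈h c∈h a≢b a≢c b≢c = begin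
    lineCommon g h + 2
      ≡⟨ cong (_+ 2) (countE-cong λ x → cong₂ _∧_ (lineAdj-xor a∈g b∈g a≢b x) (lineAdj-xor a∈h c∈h a≢c x)) ⟩
    countE xors + (1 + (1 + 0))
      ≡⟨ cong₂ (λ c₁ c₂ → countE xors + (c₁ + (c₂ + 0)))
               (sym (countE-edge-both-∈ₑ a∈g b∈g a≢b)) (sym (countE-edge-both-∈ₑ a∈h c∈h a≢c)) ⟩
    countE xors + (countE (λ x → a ∈ₑ x ∧ b ∈ₑ x) + (countE (λ x → a ∈ₑ x ∧ c ∈ₑ x) + 0))
      ≡⟨ Σcount-cong (_ ∷ _ ∷ _ ∷ []) (_ ∷ _ ∷ [])
           (λ i → 𝟙-xor-xor (a ∈ₑ to i) (b ∈ₑ to i) (c ∈ₑ to i) (third-∉ₑ (to i) a≢b a≢c b≢c)) ⟩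
    countE (a ∈ₑ_) + (countE (λ x → b ∈ₑ x ∧ c ∈ₑ x) + 0)
      ≡⟨ cong₂ _+_ (countE-∈ₑ a) (trans (ℕₚ.+-identityʳ _) (countE-both-∈ₑ b c b≢c)) ⟩
    degree Γ a + 𝟙 (adj Γ b c) ∎
    where
    open ≡-Reasoning
    xors : E → Bool
    xors x = (a ∈ₑ x xor b ∈ₑ x) ∧ (a ∈ₑ x xor c ∈ₑ x)

  private
    lineCommon-disjoint : ∀ {a b c d g h} → a ∈ₑ g ≡ true → b ∈ₑ g ≡ true → c ∈ₑ h ≡ true → d ∈ₑ h ≡ true →
      a ≢ b → a ≢ c → a ≢ d → b ≢ c → b ≢ d → c ≢ d →
      lineCommon g h ≡ 𝟙 (adj Γ a c) + (𝟙 (adj Γ a d) + (𝟙 (adj Γ b c) + (𝟙 (adj Γ b d) + 0)))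
    lineCommon-disjoint {a} {b} {c} {d} {g} {h} a∈g b∈g c∈h d∈h a≢b a≢c a≢d b≢c b≢d c≢d = begin
      lineCommon g h
        ≡⟨ sym (ℕₚ.+-identityʳ _) ⟩
      lineCommon g h + 0
        ≡⟨ cong (_+ 0) (countE-cong λ x → cong₂ _∧_ (lineAdj-xor a∈g b∈g a≢b x) (lineAdj-xor c∈h d∈h c≢d x)) ⟩
      countE (λ x → (a ∈ₑ x xor b ∈ₑ x) ∧ (c ∈ₑ x xor d ∈ₑ x)) + 0
        ≡⟨ Σcount-cong (_ ∷ []) (_ ∷ _ ∷ _ ∷ _ ∷ [])
             (λ i → 𝟙-xor∧xor (a ∈ₑ to i) (b ∈ₑ to i) (c ∈ₑ to i) (d ∈ₑ to i)
                      (third-∉ₑ (to i) a≢b a≢c b≢c) (third-∉ₑ (to i) a≢b a≢d b≢d)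
                      (third-∉ₑ (to i) a≢c a≢d c≢d) (third-∉ₑ (to i) b≢c b≢d c≢d)) ⟩
      countE (both a c) + (countE (both a d) + (countE (both b c) + (countE (both b d) + 0)))
        ≡⟨ cong₂ _+_ (countE-both-∈ₑ a c a≢c) (cong₂ _+_ (countE-both-∈ₑ a d a≢d)
             (cong₂ _+_ (countE-both-∈ₑ b c b≢c) (cong (_+ 0) (countE-both-∈ₑ b d b≢d)))) ⟩
      𝟙 (adj Γ a c) + (𝟙 (adj Γ a d) + (𝟙 (adj Γ b c) + (𝟙 (adj Γ b d) + 0))) ∎
      where
      open ≡-Reasoning
      both : V → V → E → Bool
      both u v x = u ∈ₑ x ∧ v ∈ₑ x

  lineCommon-nonadjacent : ∀ {a b c d g h} → lineAdj Γ g h ≡ false → g ≢ h →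
    a ∈ₑ g ≡ true → b ∈ₑ g ≡ true → a ≢ b → c ∈ₑ h ≡ true → d ∈ₑ h ≡ true → c ≢ d →
    lineCommon g h ≡ 𝟙 (adj Γ a c) + (𝟙 (adj Γ a d) + (𝟙 (adj Γ b c) + (𝟙 (adj Γ b d) + 0)))
  lineCommon-nonadjacent {g = g} {h} ¬gh g≢h a∈g b∈g a≢b c∈h d∈h c≢d =
    lineCommon-disjoint a∈g b∈g c∈h d∈h a≢b (apart a∈g c∈h) (apart a∈g d∈h) (apart b∈g c∈h) (apart b∈g d∈h) c≢d
    where
    apart : ∀ {u v} → u ∈ₑ g ≡ true → v ∈ₑ h ≡ true → u ≢ v
    apart = nonadjacent⇒disjoint ¬gh g≢h

-- Cliques of a line graph

⊆-or-counterexample : ∀ {A : Set} {m} → Fin m ↔ A → (P Q : A → Bool) →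
  (∀ a → P a ≡ true → Q a ≡ true) ⊎ (∃ λ a → P a ≡ true × Q a ≡ false)
⊆-or-counterexample {A} enum P Q with any? (λ i → (P (to i) Boolₚ.≟ true) ×-dec (Q (to i) Boolₚ.≟ false))
  where open Inverse enum
... | yes (i , Pi , Qi) = inj₂ (Inverse.to enum i , Pi , Qi)
... | no  ¬PQ           = inj₁ λ a Pa → ¬-not λ Qa → ¬PQ (Inverse.from enum a , at-a {P} Pa , at-a {Q} Qa)
  where
  at-a : ∀ {R : A → Bool} {a b} → R a ≡ b → R (Inverse.to enum (Inverse.from enum a)) ≡ b
  at-a {R} {a} Ra = trans (cong R (Inverse.strictlyInverseˡ enum a)) Ra

module LineClique (Γ : Graph) (C : Edge Γ → Bool)
  (clique : ∀ g h → C g ≡ true → C h ≡ true → g ≢ h → lineAdj Γ g h ≡ true) where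
  open EdgesOf Γ

  record Triangle : Set where
    field
      a b c          : V
      a≢b            : a ≢ b
      a≢c            : a ≢ c
      b≢c            : b ≢ c
      ab bc ac       : E
      a∈ab           : a ∈ₑ ab ≡ true
      b∈ab           : b ∈ₑ ab ≡ true
      b∈bc           : b ∈ₑ bc ≡ true
      c∈bc           : c ∈ₑ bc ≡ true
      a∈ac           : a ∈ₑ ac ≡ true
      c∈ac           : c ∈ₑ ac ≡ true
      ab∈C           : C ab ≡ true
      bc∈C           : C bc ≡ true
      ac∈C           : C ac ≡ true

  data Shape : Set where
    star     : ∀ x → (∀ g → C g ≡ true → x ∈ₑ g ≡ true) → Shape
    triangle : Triangle → Shape

  clique-meet : ∀ {u v g h} → C g ≡ true → C h ≡ true → u ∈ₑ g ≡ true → v ∈ₑ g ≡ true → u ≢ v →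
    u ∈ₑ h ≡ false → v ∈ₑ h ≡ true
  clique-meet {u} {v} {g} {h} Cg Ch u∈g v∈g u≢v u∉h =
    trans (sym (cong (_xor v ∈ₑ h) u∉h)) (trans (sym (lineAdj-xor u∈g v∈g u≢v h))
          (clique g h Cg Ch (∈ₑ∧∉ₑ⇒edge≢ u∈g u∉h)))

  shape : ∀ {m} → Fin m ↔ E → ∀ g → C g ≡ true → Shape
  shape enum g Cg with ⊆-or-counterexample enum C (end₁ g ∈ₑ_) | ⊆-or-counterexample enum C (end₂ g ∈ₑ_)
  ... | inj₁ C∋a | _ = star (end₁ g) C∋a
  ... | inj₂ _ | inj₁ C∋b = star (end₂ g) C∋b
  ... | inj₂ (h₁ , Ch₁ , a∉h₁) | inj₂ (h₂ , Ch₂ , b∉h₂) = triangle record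
    { a = a ; b = b ; c = c ; a≢b = a≢b ; a≢c = a≢c ; b≢c = b≢c
    ; ab = g ; bc = h₁ ; ac = h₂
    ; a∈ab = end₁-∈ₑ g ; b∈ab = end₂-∈ₑ g ; b∈bc = b∈h₁ ; c∈bc = other-∈ₑ b h₁ ; a∈ac = a∈h₂ ; c∈ac = c∈h₂
    ; ab∈C = Cg ; bc∈C = Ch₁ ; ac∈C = Ch₂ }
    where
    a b c : V
    a = end₁ g
    b = end₂ g
    c = other b h₁
    a≢b : a ≢ b
    a≢b = end₁≢end₂ g
    b∈h₁ : b ∈ₑ h₁ ≡ true
    b∈h₁ = clique-meet Cg Ch₁ (end₁-∈ₑ g) (end₂-∈ₑ g) a≢b a∉h₁
    a∈h₂ : a ∈ₑ h₂ ≡ true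
    a∈h₂ = clique-meet Cg Ch₂ (end₂-∈ₑ g) (end₁-∈ₑ g) (a≢b ∘ sym) b∉h₂
    b≢c : b ≢ c
    b≢c = other-≢ b h₁ b∈h₁
    a≢c : a ≢ c
    a≢c = ∈ₑ∧∉ₑ⇒≢ (other-∈ₑ b h₁) a∉h₁ ∘ sym
    c∈h₂ : c ∈ₑ h₂ ≡ true
    c∈h₂ = clique-meet Ch₁ Ch₂ b∈h₁ (other-∈ₑ b h₁) b≢c b∉h₂

  private
    xor-triangle : ∀ x y z → x xor y ≡ true → y xor z ≡ true → x xor z ≡ true → ⊥
    xor-triangle true  true  _     () _  _
    xor-triangle true  false true  _  _  ()
    xor-triangle true  false false _  () _
    xor-triangle false true  true  _  () _
    xor-triangle false true  false _  _  ()
    xor-triangle false false _     () _  _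

  module _ (T : Triangle) where
    open Triangle T

    -- An edge through a fourth vertex p would meet each side of the triangle in exactly one end.
    triangle-closed : ∀ {p h} → C h ≡ true → p ∈ₑ h ≡ true → p ≢ a → p ≢ b → p ≢ c → ⊥
    triangle-closed {p} {h} Ch p∈h p≢a p≢b p≢c = xor-triangle (a ∈ₑ h) (b ∈ₑ h) (c ∈ₑ h)
      (trans (sym (lineAdj-xor a∈ab b∈ab a≢b h)) (clique ab h ab∈C Ch (avoids a∈ab b∈ab a≢b p≢a p≢b)))
      (trans (sym (lineAdj-xor b∈bc c∈bc b≢c h)) (clique bc h bc∈C Ch (avoids b∈bc c∈bc b≢c p≢b p≢c)))
      (trans (sym (lineAdj-xor a∈ac c∈ac a≢c h)) (clique ac h ac∈C Ch (avoids a∈ac c∈ac a≢c p≢a p≢c)))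
      where
      avoids : ∀ {u v g} → u ∈ₑ g ≡ true → v ∈ₑ g ≡ true → u ≢ v → p ≢ u → p ≢ v → g ≢ h
      avoids {g = g} u∈g v∈g u≢v p≢u p≢v g≡h =
        ∈ₑ∧∉ₑ⇒edge≢ p∈h (third-∉ₑ g u≢v (p≢u ∘ sym) (p≢v ∘ sym) u∈g v∈g) (sym g≡h)

  rotate : Triangle → Triangle
  rotate T = record
    { a = b ; b = c ; c = a ; a≢b = b≢c ; a≢c = a≢b ∘ sym ; b≢c = a≢c ∘ sym
    ; ab = bc ; bc = ac ; ac = ab
    ; a∈ab = b∈bc ; b∈ab = c∈bc ; b∈bc = c∈ac ; c∈bc = a∈ac ; a∈ac = b∈ab ; c∈ac = a∈ab
    ; ab∈C = bc∈C ; bc∈C = ac∈C ; ac∈C = ab∈C }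
    where open Triangle T

-- Line graphs of complete and complete bipartite graphs

lineGraph-≅ : {Γ L : Graph} → IsLineGraphOf L Γ → {X : Set} (R : X → X → Bool) (φ : Edge Γ ↔ X) →
  (∀ g h → R (Inverse.to φ g) (Inverse.to φ h) ≡ lineAdj Γ g h) → L ≅ X on R
lineGraph-≅ (enum , enum-adj) R φ φ-adj = ↔-trans enum φ , λ u v → trans (φ-adj _ _) (enum-adj u v)

JVert-≡ : ∀ {m} {x y : JVert m} → proj₁ (proj₁ x) ≡ proj₁ (proj₁ y) → proj₂ (proj₁ x) ≡ proj₂ (proj₁ y) → x ≡ y
JVert-≡ {x = _ , l} {_ , l′} refl refl rewrite ℕₚ.≤-irrelevant l l′ = refl

record CompleteCore (Γ : Graph) : Set where
  field
    core          : Fin (n Γ) → Bool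
    edge-in-core  : ∀ u v → adj Γ u v ≡ true → core u ≡ true
    core-complete : ∀ u v → core u ≡ true → core v ≡ true → u ≢ v → adj Γ u v ≡ true
    3≤|core|      : 3 ≤ count core

record BipartiteCore (Γ : Graph) : Set where
  field
    left right    : Fin (n Γ) → Bool
    size          : ℕ
    |left|        : count left ≡ size
    |right|       : count right ≡ size
    2≤size        : 2 ≤ size
    disjoint      : ∀ u → left u ≡ true → right u ≡ true → ⊥
    edge-across   : ∀ u v → adj Γ u v ≡ true → (left u ≡ true × right v ≡ true) ⊎ (right u ≡ true × left v ≡ true)
    across-adj    : ∀ u v → left u ≡ true → right v ≡ true → adj Γ u v ≡ true

module CompleteCoreLineGraph (Γ : Graph) (K : CompleteCore Γ) where
  open EdgesOf Γ
  open CompleteCore K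

  private
    core-∈ₑ : ∀ {u g} → u ∈ₑ g ≡ true → core u ≡ true
    core-∈ₑ {u} {g} u∈g with ∈ₑ⇒end u∈g
    ... | inj₁ refl = edge-in-core _ _ (adj-ends g)
    ... | inj₂ refl = edge-in-core _ _ (adj-sym (adj-ends g))

    end₁∈core : E → Elements core
    end₁∈core g = end₁ g , core-∈ₑ (end₁-∈ₑ g)
    end₂∈core : E → Elements core
    end₂∈core g = end₂ g , core-∈ₑ (end₂-∈ₑ g)

    toPair : E → JVert (count core)
    toPair g = (index core (end₁∈core g) , index core (end₂∈core g)) , index-mono core _ _ (proj₁ (proj₂ g))

    fromPair : JVert (count core) → E
    fromPair ((i , j) , i<j) = (proj₁ (enumerate core i) , proj₁ (enumerate core j)) , enumerate-mono core i<j ,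
      core-complete _ _ (proj₂ (enumerate core i)) (proj₂ (enumerate core j))
                    (λ eq → <-irrefl eq (enumerate-mono core i<j))

  toJohnson : E ↔ JVert (count core)
  toJohnson = mk↔ₛ′ toPair fromPair
    (λ { ((i , j) , _) → JVert-≡ (trans (index-cong core refl) (index-enumerate core i))
                                   (trans (index-cong core refl) (index-enumerate core j)) })
    (λ g → edge-≡ (cong proj₁ (enumerate-index core _)) (cong proj₁ (enumerate-index core _)))

  toJohnson-adj : ∀ g h → johnsonAdj (count core) (toPair g) (toPair h) ≡ lineAdj Γ g h
  toJohnson-adj g h
    rewrite eqF-index core (end₁∈core g) (end₁∈core h) | eqF-index core (end₁∈core g) (end₂∈core h)
          | eqF-index core (end₂∈core g) (end₁∈core h) | eqF-index core (end₂∈core g) (end₂∈core h) = refl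

  -- Two disjoint edges span four vertices of the complete core, hence have four common neighbours.
  lineCommon-disjoint≡4 : ∀ {m} (enum : Fin m ↔ E) {g h} → lineAdj Γ g h ≡ false → g ≢ h →
    LineCounts.lineCommon Γ enum g h ≡ 4
  lineCommon-disjoint≡4 enum {g} {h} ¬gh g≢h =
    trans (LineCounts.lineCommon-nonadjacent Γ enum ¬gh g≢h (end₁-∈ₑ g) (end₂-∈ₑ g) (end₁≢end₂ g)
                                                        (end₁-∈ₑ h) (end₂-∈ₑ h) (end₁≢end₂ h))
          (cong₂ _+_ (across (end₁-∈ₑ g) (end₁-∈ₑ h)) (cong₂ _+_ (across (end₁-∈ₑ g) (end₂-∈ₑ h))
          (cong₂ _+_ (across (end₂-∈ₑ g) (end₁-∈ₑ h)) (cong (_+ 0) (across (end₂-∈ₑ g) (end₂-∈ₑ h))))))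
    where
    across : ∀ {x y} → x ∈ₑ g ≡ true → y ∈ₑ h ≡ true → 𝟙 (adj Γ x y) ≡ 1
    across x∈g y∈h = cong 𝟙 (core-complete _ _ (core-∈ₑ x∈g) (core-∈ₑ y∈h) (nonadjacent⇒disjoint ¬gh g≢h x∈g y∈h))

rookAdj′ : ∀ {a b} → Fin a × Fin b → Fin a × Fin b → Bool
rookAdj′ (x , y) (x′ , y′) = not (eqF x x′ ∧ eqF y y′) ∧ (eqF x x′ ∨ eqF y y′)

rookAdj′-square : ∀ {L : Graph} {a b} m → a ≡ m → b ≡ m →
  L ≅ (Fin a × Fin b) on rookAdj′ → L ≅ (Fin m × Fin m) on rookAdj m
rookAdj′-square m refl refl L≅ = L≅

module BipartiteCoreLineGraph (Γ : Graph) (B : BipartiteCore Γ) where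
  open EdgesOf Γ
  open BipartiteCore B

  left≢right : ∀ {u v} → left u ≡ true → right v ≡ true → u ≢ v
  left≢right lu rv refl = disjoint _ lu rv

  left-nonadjacent : ∀ {u v} → left u ≡ true → left v ≡ true → adj Γ u v ≡ false
  left-nonadjacent {u} {v} lu lv = ¬-not λ a → case edge-across u v a of λ where
    (inj₁ (_ , rv)) → disjoint v lv rv
    (inj₂ (ru , _)) → disjoint u lu ru

  right-nonadjacent : ∀ {u v} → right u ≡ true → right v ≡ true → adj Γ u v ≡ false
  right-nonadjacent {u} {v} ru rv = ¬-not λ a → case edge-across u v a of λ where
    (inj₁ (lu , _)) → disjoint u lu ru
    (inj₂ (_ , lv)) → disjoint v lv rv

  record Oriented (g : E) : Set where
    field
      lend rend   : V
      lend-∈ₑ     : lend ∈ₑ g ≡ true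
      rend-∈ₑ     : rend ∈ₑ g ≡ true
      lend-left   : left lend ≡ true
      rend-right  : right rend ≡ true

    lend≢rend : lend ≢ rend
    lend≢rend = left≢right lend-left rend-right

  orient : ∀ g → Oriented g
  orient g with edge-across (end₁ g) (end₂ g) (adj-ends g)
  ... | inj₁ (l₁ , r₂) = record { lend = end₁ g ; rend = end₂ g ; lend-∈ₑ = end₁-∈ₑ g ; rend-∈ₑ = end₂-∈ₑ g
                                ; lend-left = l₁ ; rend-right = r₂ }
  ... | inj₂ (r₁ , l₂) = record { lend = end₂ g ; rend = end₁ g ; lend-∈ₑ = end₂-∈ₑ g ; rend-∈ₑ = end₁-∈ₑ g
                                ; lend-left = l₂ ; rend-right = r₁ }

  module _ {g} (o : Oriented g) where
    open Oriented o

    left-∈ₑ : ∀ {v} → left v ≡ true → v ∈ₑ g ≡ eqF v lend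
    left-∈ₑ {v} lv = ⇔⇒≡ on-g (λ e → subst (λ x → x ∈ₑ g ≡ true) (sym (eqF⇒≡ e)) lend-∈ₑ)
      where
      on-g : v ∈ₑ g ≡ true → eqF v lend ≡ true
      on-g v∈g with two-ends v∈g lend-∈ₑ rend-∈ₑ
      ... | inj₁ refl        = eqF-refl v
      ... | inj₂ (inj₁ refl) = contradiction refl (left≢right lv rend-right)
      ... | inj₂ (inj₂ eq)   = contradiction eq lend≢rend

    right-∈ₑ : ∀ {v} → right v ≡ true → v ∈ₑ g ≡ eqF v rend
    right-∈ₑ {v} rv = ⇔⇒≡ on-g (λ e → subst (λ x → x ∈ₑ g ≡ true) (sym (eqF⇒≡ e)) rend-∈ₑ)
      where
      on-g : v ∈ₑ g ≡ true → eqF v rend ≡ true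
      on-g v∈g with two-ends v∈g lend-∈ₑ rend-∈ₑ
      ... | inj₁ refl        = contradiction refl (left≢right lend-left rv)
      ... | inj₂ (inj₁ refl) = eqF-refl v
      ... | inj₂ (inj₂ eq)   = contradiction eq lend≢rend

    lend-unique : ∀ {v} → v ∈ₑ g ≡ true → left v ≡ true → lend ≡ v
    lend-unique v∈g lv = sym (eqF⇒≡ (trans (sym (left-∈ₑ lv)) v∈g))

    rend-unique : ∀ {v} → v ∈ₑ g ≡ true → right v ≡ true → rend ≡ v
    rend-unique v∈g rv = sym (eqF⇒≡ (trans (sym (right-∈ₑ rv)) v∈g))

  private
    toCell : E → Fin (count left) × Fin (count right)
    toCell g = index left (lend , lend-left) , index right (rend , rend-right)
      where open Oriented (orient g)

    fromCell : Fin (count left) × Fin (count right) → E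
    fromCell (i , j) = edge (proj₁ (enumerate left i)) (proj₁ (enumerate right j))
      (across-adj _ _ (proj₂ (enumerate left i)) (proj₂ (enumerate right j)))

    toCell-fromCell : ∀ c → toCell (fromCell c) ≡ c
    toCell-fromCell (i , j) = cong₂ _,_
      (trans (index-cong left (lend-unique o (∈ₑ-edge₁ _ _ _) (proj₂ (enumerate left i)))) (index-enumerate left i))
      (trans (index-cong right (rend-unique o (∈ₑ-edge₂ _ _ _) (proj₂ (enumerate right j)))) (index-enumerate right j))
      where o = orient (fromCell (i , j))

    fromCell-toCell : ∀ g → fromCell (toCell g) ≡ g
    fromCell-toCell g = edge-determined (∈ₑ-edge₁ _ _ _) (∈ₑ-edge₂ _ _ _)
      (subst (λ x → x ∈ₑ g ≡ true) (sym (cong proj₁ (enumerate-index left _))) lend-∈ₑ)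
      (subst (λ x → x ∈ₑ g ≡ true) (sym (cong proj₁ (enumerate-index right _))) rend-∈ₑ)
      (λ eq → lend≢rend (trans (sym (cong proj₁ (enumerate-index left _)))
                               (trans eq (cong proj₁ (enumerate-index right _)))))
      where open Oriented (orient g)

  toRook : E ↔ (Fin (count left) × Fin (count right))
  toRook = mk↔ₛ′ toCell fromCell toCell-fromCell fromCell-toCell

  toRook-adj : ∀ g h → rookAdj′ (toCell g) (toCell h) ≡ lineAdj Γ g h
  toRook-adj g h = begin
    rookAdj′ (toCell g) (toCell h)
      ≡⟨ cong₂ (λ x y → not (x ∧ y) ∧ (x ∨ y)) (eqF-index left _ _) (eqF-index right _ _) ⟩
    not (eqF lg lh ∧ eqF rg rh) ∧ (eqF lg lh ∨ eqF rg rh)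
      ≡⟨ trans (∧-comm (not (eqF lg lh ∧ eqF rg rh)) _) (sym (xor-is-ok (eqF lg lh) (eqF rg rh))) ⟩
    eqF lg lh xor eqF rg rh
      ≡⟨ sym (cong₂ _xor_ (left-∈ₑ (orient h) (Oriented.lend-left og)) (right-∈ₑ (orient h) (Oriented.rend-right og))) ⟩
    lg ∈ₑ h xor rg ∈ₑ h
      ≡⟨ sym (lineAdj-xor (Oriented.lend-∈ₑ og) (Oriented.rend-∈ₑ og) (Oriented.lend≢rend og) h) ⟩
    lineAdj Γ g h ∎
    where
    open ≡-Reasoning
    og : Oriented g
    og = orient g
    lg rg lh rh : V
    lg = Oriented.lend og
    rg = Oriented.rend og
    lh = Oriented.lend (orient h)
    rh = Oriented.rend (orient h)

  lineCommon-disjoint≡2 : ∀ {m} (enum : Fin m ↔ E) {g h} → lineAdj Γ g h ≡ false → g ≢ h →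
    LineCounts.lineCommon Γ enum g h ≡ 2
  lineCommon-disjoint≡2 enum {g} {h} ¬gh g≢h =
    trans (LineCounts.lineCommon-nonadjacent Γ enum ¬gh g≢h lend-∈ₑ rend-∈ₑ lend≢rend
                                                        (lend-∈ₑ′) (rend-∈ₑ′) (lend≢rend′))
          (cong₂ _+_ (cong 𝟙 (left-nonadjacent lend-left lend-left′))
          (cong₂ _+_ (cong 𝟙 (across-adj _ _ lend-left rend-right′))
          (cong₂ _+_ (cong 𝟙 (adj-sym (across-adj _ _ lend-left′ rend-right)))
                     (cong (_+ 0) (cong 𝟙 (right-nonadjacent rend-right rend-right′))))))
    where
    open Oriented (orient g)
    open Oriented (orient h) using () renaming (lend-∈ₑ to lend-∈ₑ′; rend-∈ₑ to rend-∈ₑ′; lend≢rend to lend≢rend′;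
                                                lend-left to lend-left′; rend-right to rend-right′)

-- Line graphs that are Neumaier

-- The octahedral graph is J(4,2).
RookJohnsonOrOctahedral : Graph → Set
RookJohnsonOrOctahedral L =
  (Σ ℕ λ s → (1 ≤ s) × (L ≅ (Fin (suc s) × Fin (suc s)) on rookAdj (suc s)))
  ⊎ (Σ ℕ λ s → (2 ≤ s) × (L ≅ JVert (suc (suc s)) on johnsonAdj (suc (suc s))))
  ⊎ (L ≅ Fin 6 on octaAdj)

≅-complete : ∀ {L : Graph} {X : Set} {R : X → X → Bool} → L ≅ X on R → (∀ x y → x ≢ y → R x y ≡ true) →
  IsComplete L
≅-complete (φ , φ-adj) R-complete u v u≢v =
  trans (sym (φ-adj u v)) (R-complete _ _ (u≢v ∘ Injection.injective (Inverse⇒Injection φ)))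

private
  v₀₁ v₀₂ v₁₂ : JVert 3
  v₀₁ = (zero , suc zero) , s≤s z≤n
  v₀₂ = (zero , suc (suc zero)) , s≤s z≤n
  v₁₂ = (suc zero , suc (suc zero)) , s≤s (s≤s z≤n)

  JVert3 : ∀ x → x ≡ v₀₁ ⊎ x ≡ v₀₂ ⊎ x ≡ v₁₂
  JVert3 ((zero , suc zero) , _)                = inj₁ (JVert-≡ refl refl)
  JVert3 ((zero , suc (suc zero)) , _)          = inj₂ (inj₁ (JVert-≡ refl refl))
  JVert3 ((suc zero , suc (suc zero)) , _)      = inj₂ (inj₂ (JVert-≡ refl refl))
  JVert3 ((zero , zero) , ())
  JVert3 ((suc zero , zero) , ())
  JVert3 ((suc zero , suc zero) , s≤s ())
  JVert3 ((suc (suc zero) , zero) , ())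
  JVert3 ((suc (suc zero) , suc zero) , s≤s ())
  JVert3 ((suc (suc zero) , suc (suc zero)) , s≤s (s≤s ()))

johnson3-complete : ∀ x y → x ≢ y → johnsonAdj 3 x y ≡ true
johnson3-complete x y x≢y with JVert3 x | JVert3 y
... | inj₁ refl        | inj₁ refl        = contradiction refl x≢y
... | inj₁ refl        | inj₂ (inj₁ refl) = refl
... | inj₁ refl        | inj₂ (inj₂ refl) = refl
... | inj₂ (inj₁ refl) | inj₁ refl        = refl
... | inj₂ (inj₁ refl) | inj₂ (inj₁ refl) = contradiction refl x≢y
... | inj₂ (inj₁ refl) | inj₂ (inj₂ refl) = refl
... | inj₂ (inj₂ refl) | inj₁ refl        = refl
... | inj₂ (inj₂ refl) | inj₂ (inj₁ refl) = refl
... | inj₂ (inj₂ refl) | inj₂ (inj₂ refl) = contradiction refl x≢y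

module _ (Γ L : Graph) (line : IsLineGraphOf L Γ) (¬complete : ¬ IsComplete L) where

  completeCore⇒johnson : (K : CompleteCore Γ) → RookJohnsonOrOctahedral L
  completeCore⇒johnson K = johnson (count core) refl 3≤|core|
    where
    open CompleteCore K
    L≅J : L ≅ JVert (count core) on johnsonAdj (count core)
    L≅J = lineGraph-≅ {Γ} {L} line (johnsonAdj (count core)) (CompleteCoreLineGraph.toJohnson Γ K)
                           (CompleteCoreLineGraph.toJohnson-adj Γ K)
    johnson : ∀ m → count core ≡ m → 3 ≤ m → RookJohnsonOrOctahedral L
    johnson (suc (suc zero))          _      (s≤s (s≤s ()))
    johnson (suc (suc (suc zero)))    |core| _ =
      contradiction (≅-complete {L} {JVert 3} {johnsonAdj 3} (subst (λ m → L ≅ JVert m on johnsonAdj m) |core| L≅J)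
                                johnson3-complete)
                    ¬complete
    johnson (suc (suc (suc (suc s)))) |core| _ =
      inj₂ (inj₁ (suc (suc s) , s≤s (s≤s z≤n) , subst (λ m → L ≅ JVert m on johnsonAdj m) |core| L≅J))

  bipartiteCore⇒rook : BipartiteCore Γ → RookJohnsonOrOctahedral L
  bipartiteCore⇒rook B = rook size |left| |right| 2≤size
    where
    open BipartiteCore B
    rook : ∀ m → count left ≡ m → count right ≡ m → 2 ≤ m → RookJohnsonOrOctahedral L
    rook (suc zero)    _      _       (s≤s ())
    rook (suc (suc s)) |left| |right| _ = inj₁ (suc s , s≤s z≤n , rookAdj′-square {L} (suc (suc s)) |left| |right|
      (lineGraph-≅ {Γ} {L} line rookAdj′ (BipartiteCoreLineGraph.toRook Γ B) (BipartiteCoreLineGraph.toRook-adj Γ B)))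

module NeumaierLineGraph
  (Γ L : Graph) (enum : Fin (n L) ↔ Edge Γ)
  (enum-adj : ∀ u v → lineAdj Γ (Inverse.to enum u) (Inverse.to enum v) ≡ adj L u v)
  (¬complete : ¬ IsComplete L)
  (k l : ℕ) (regular : IsRegular L k) (common : ∀ u v → adj L u v ≡ true → commonNeighbours L u v ≡ l)
  (C : Fin (n L) → Bool) (regularClique : IsRegularClique L C)
  where

  open EdgesOf Γ
  open LineCounts Γ enum
  open Inverse enum using (to; from; strictlyInverseˡ; strictlyInverseʳ)

  e : ℕ
  e = proj₁ (proj₂ regularClique)

  1≤e : 1 ≤ e
  1≤e = proj₁ (proj₂ (proj₂ regularClique))

  deg : V → ℕ
  deg = degree Γ

  Cₑ : E → Bool
  Cₑ g = C (from g)

  lineAdj≡adj : ∀ g i → lineAdj Γ g (to i) ≡ adj L (from g) i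
  lineAdj≡adj g i = trans (cong (λ x → lineAdj Γ x (to i)) (sym (strictlyInverseˡ g))) (enum-adj (from g) i)

  lineAdj≡adj′ : ∀ g h → lineAdj Γ g h ≡ adj L (from g) (from h)
  lineAdj≡adj′ g h = trans (cong (lineAdj Γ g) (sym (strictlyInverseˡ h))) (lineAdj≡adj g (from h))

  from-injective : ∀ {g h} → from g ≡ from h → g ≡ h
  from-injective = Injection.injective (Inverse⇒Injection (↔-sym enum))

  lineDegree≡k : ∀ g → lineDegree g ≡ k
  lineDegree≡k g = trans (count-cong (lineAdj≡adj g)) (regular (from g))

  lineCommon≡l : ∀ g h → lineAdj Γ g h ≡ true → lineCommon g h ≡ l
  lineCommon≡l g h gh = trans (count-cong λ i → cong₂ _∧_ (lineAdj≡adj g i) (lineAdj≡adj h i))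
                              (common (from g) (from h) (trans (sym (lineAdj≡adj′ g h)) gh))

  Cₑ-clique : ∀ g h → Cₑ g ≡ true → Cₑ h ≡ true → g ≢ h → lineAdj Γ g h ≡ true
  Cₑ-clique g h Cg Ch g≢h =
    trans (lineAdj≡adj′ g h) (proj₁ regularClique (from g) (from h) Cg Ch (g≢h ∘ from-injective))

  Cₑ-nexus : ∀ g → Cₑ g ≡ false → countE (λ h → Cₑ h ∧ lineAdj Γ g h) ≡ e
  Cₑ-nexus g Cg = trans (count-cong λ i → cong₂ _∧_ (cong C (strictlyInverseʳ i)) (lineAdj≡adj g i))
                        (proj₂ (proj₂ (proj₂ regularClique)) (from g) Cg)

  to-injective : ∀ {u v} → to u ≡ to v → u ≡ v
  to-injective = Injection.injective (Inverse⇒Injection enum)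

  ¬lineComplete : ¬ (∀ g h → g ≢ h → lineAdj Γ g h ≡ true)
  ¬lineComplete complete = ¬complete λ u v u≢v →
    trans (sym (enum-adj u v)) (complete (to u) (to v) (u≢v ∘ to-injective))

  2≤|Cₑ| : 2 ≤ countE Cₑ
  2≤|Cₑ| = subst (2 ≤_) (sym (count-cong {q = C} λ i → cong C (strictlyInverseʳ i)))
                 (regularClique-size≥2 L regular ¬complete regularClique)

  edge-outside-clique : ∃ λ g → Cₑ g ≡ false
  edge-outside-clique with ⊆-or-counterexample enum (λ _ → true) Cₑ
  ... | inj₁ all∈C  = contradiction (λ g h → Cₑ-clique g h (all∈C g refl) (all∈C h refl)) ¬lineComplete
  ... | inj₂ (g , _ , Cg) = g , Cg

  nexus-witness : ∀ g → Cₑ g ≡ false → ∃ λ h → Cₑ h ≡ true × lineAdj Γ g h ≡ true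
  nexus-witness g Cg with count-witness {p = λ i → Cₑ (to i) ∧ lineAdj Γ g (to i)}
                                        (subst (1 ≤_) (sym (Cₑ-nexus g Cg)) 1≤e)
  ... | i , Ch∧gh = to i , ∧-conicalˡ _ (lineAdj Γ g (to i)) Ch∧gh , ∧-conicalʳ (Cₑ (to i)) _ Ch∧gh

  degree-sum : ∀ {u v g} → u ∈ₑ g ≡ true → v ∈ₑ g ≡ true → u ≢ v → k + 2 ≡ deg u + deg v
  degree-sum {g = g} u∈g v∈g u≢v = trans (cong (_+ 2) (sym (lineDegree≡k g))) (lineDegree-ends u∈g v∈g u≢v)

  adj⇒degree-sum : ∀ {u v} → adj Γ u v ≡ true → k + 2 ≡ deg u + deg v
  adj⇒degree-sum {u} {v} uv = degree-sum (∈ₑ-edge₁ u v uv) (∈ₑ-edge₂ u v uv) (adj⇒≢ uv)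

  common-neighbour⇒same-degree : ∀ {u v w} → adj Γ u v ≡ true → adj Γ u w ≡ true → deg v ≡ deg w
  common-neighbour⇒same-degree {u} uv uw =
    ℕₚ.+-cancelˡ-≡ (deg u) _ _ (trans (sym (adj⇒degree-sum uv)) (adj⇒degree-sum uw))

  open LineClique Γ Cₑ Cₑ-clique

  module _ (T : Triangle) where
    open Triangle T

    edge-avoiding-triangle-impossible : ∀ g → a ∈ₑ g ≡ false → b ∈ₑ g ≡ false → c ∈ₑ g ≡ false → ⊥
    edge-avoiding-triangle-impossible g a∉g b∉g c∉g = no-clique-neighbour (nexus-witness g g∉C)
      where
      off-triangle : ∀ {p h} → p ∈ₑ g ≡ true → Cₑ h ≡ true → p ∈ₑ h ≡ false
      off-triangle p∈g h∈C = ¬-not λ p∈h →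
        triangle-closed T h∈C p∈h (∈ₑ∧∉ₑ⇒≢ p∈g a∉g) (∈ₑ∧∉ₑ⇒≢ p∈g b∉g) (∈ₑ∧∉ₑ⇒≢ p∈g c∉g)
      g∉C : Cₑ g ≡ false
      g∉C = ¬-not λ g∈C → case trans (sym (end₁-∈ₑ g)) (off-triangle (end₁-∈ₑ g) g∈C) of λ ()
      no-clique-neighbour : (∃ λ h → Cₑ h ≡ true × lineAdj Γ g h ≡ true) → ⊥
      no-clique-neighbour (h , h∈C , gh) = case trans (sym gh) (trans (lineAdj-ends-xor g h)
        (cong₂ _xor_ (off-triangle (end₁-∈ₑ g) h∈C) (off-triangle (end₂-∈ₑ g) h∈C))) of λ ()

    meets-triangle : ∀ g → ∃ λ r → r ∈ a ∷ b ∷ c ∷ [] × r ∈ₑ g ≡ true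
    meets-triangle g with a ∈ₑ g in a∈g | b ∈ₑ g in b∈g | c ∈ₑ g in c∈g
    ... | true  | _     | _     = a , here refl , a∈g
    ... | false | true  | _     = b , there (here refl) , b∈g
    ... | false | false | true  = c , there (there (here refl)) , c∈g
    ... | false | false | false = ⊥-elim (edge-avoiding-triangle-impossible g a∈g b∈g c∈g)

    -- g₀ leaves the triangle at a; its far end d completes a K₄, and regularity leaves no room for other edges.
    module K₄ (g₀ : E) (a∈g₀ : a ∈ₑ g₀ ≡ true) (b∉g₀ : b ∈ₑ g₀ ≡ false) (c∉g₀ : c ∈ₑ g₀ ≡ false) where
      d : V
      d = other a g₀

      a≢d : a ≢ d
      a≢d = other-≢ a g₀ a∈g₀
      b≢d : b ≢ d
      b≢d = ∈ₑ∧∉ₑ⇒≢ (other-∈ₑ a g₀) b∉g₀ ∘ sym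
      c≢d : c ≢ d
      c≢d = ∈ₑ∧∉ₑ⇒≢ (other-∈ₑ a g₀) c∉g₀ ∘ sym

      a~b : adj Γ a b ≡ true
      a~b = ∈ₑ⇒adj a∈ab b∈ab a≢b
      a~c : adj Γ a c ≡ true
      a~c = ∈ₑ⇒adj a∈ac c∈ac a≢c
      b~c : adj Γ b c ≡ true
      b~c = ∈ₑ⇒adj b∈bc c∈bc b≢c
      a~d : adj Γ a d ≡ true
      a~d = ∈ₑ⇒adj a∈g₀ (other-∈ₑ a g₀) a≢d

      nbrs-d⊆triangle : adj Γ d ⊆ memberOf (a ∷ b ∷ c ∷ [])
      nbrs-d⊆triangle y d~y with meets-triangle (edge d y d~y)
      ... | r , r∈abc , r∈dy = ∈⇒memberOf (subst (_∈ a ∷ b ∷ c ∷ []) r≡y r∈abc)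
        where
        r≢d : r ≢ d
        r≢d = All.lookup (a≢d ∷ b≢d ∷ c≢d ∷ []) r∈abc
        r≡y : r ≡ y
        r≡y = ∈ₑ-third-end (∈ₑ-edge₁ d y d~y) r∈dy (∈ₑ-edge₂ d y d~y) (r≢d ∘ sym) (adj⇒≢ d~y)

      deg-d≡deg-b : deg d ≡ deg b
      deg-d≡deg-b = common-neighbour⇒same-degree a~d a~b
      deg-a≡deg-b : deg a ≡ deg b
      deg-a≡deg-b = common-neighbour⇒same-degree (adj-sym a~c) (adj-sym b~c)
      deg-c≡deg-b : deg c ≡ deg b
      deg-c≡deg-b = common-neighbour⇒same-degree a~c a~b

      |abc|≡3 : count (memberOf (a ∷ b ∷ c ∷ [])) ≡ 3
      |abc|≡3 = count-memberOf ((a≢b ∷ a≢c ∷ []) ∷ (b≢c ∷ []) ∷ [] ∷ [])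

      deg-d≤3 : deg d ≤ 3
      deg-d≤3 = ℕₚ.≤-trans (count-mono nbrs-d⊆triangle) (ℕₚ.≤-reflexive |abc|≡3)

      3≤deg-d : 3 ≤ deg d
      3≤deg-d = begin
        3                                 ≡⟨ sym (count-memberOf ((b≢c ∷ b≢d ∷ []) ∷ (c≢d ∷ []) ∷ [] ∷ [])) ⟩
        count (memberOf (b ∷ c ∷ d ∷ [])) ≤⟨ count-mono (adjacent-to-all⇒⊆ Γ (a~b ∷ a~c ∷ a~d ∷ [])) ⟩
        deg a                             ≡⟨ trans deg-a≡deg-b (sym deg-d≡deg-b) ⟩
        deg d                             ∎
        where open ℕₚ.≤-Reasoning

      triangle⊆nbrs-d : memberOf (a ∷ b ∷ c ∷ []) ⊆ adj Γ d
      triangle⊆nbrs-d = ⊆∧count≥⇒⊇ nbrs-d⊆triangle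
        (ℕₚ.≤-trans (ℕₚ.≤-reflexive |abc|≡3) 3≤deg-d)

      K : List V
      K = a ∷ b ∷ c ∷ d ∷ []

      K-unique : Unique K
      K-unique = (a≢b ∷ a≢c ∷ a≢d ∷ []) ∷ (b≢c ∷ b≢d ∷ []) ∷ (c≢d ∷ []) ∷ [] ∷ []

      K-clique : Pairwise-adjacent Γ K
      K-clique = (a~b ∷ a~c ∷ a~d ∷ []) ∷ (b~c ∷ adj-sym d~b ∷ []) ∷ (adj-sym d~c ∷ []) ∷ [] ∷ []
        where
        d~b : adj Γ d b ≡ true
        d~b = triangle⊆nbrs-d b (∈⇒memberOf {as = a ∷ b ∷ c ∷ []} (there (here refl)))
        d~c : adj Γ d c ≡ true
        d~c = triangle⊆nbrs-d c (∈⇒memberOf {as = a ∷ b ∷ c ∷ []} (there (there (here refl))))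

      K-degree : ∀ {x} → x ∈ K → suc (deg x) ≤ length K
      K-degree x∈K = s≤s (ℕₚ.≤-trans (ℕₚ.≤-reflexive (All.lookup same-degree x∈K)) deg-d≤3)
        where
        same-degree : All.All (λ x → deg x ≡ deg d) K
        same-degree = trans deg-a≡deg-b (sym deg-d≡deg-b) ∷ sym deg-d≡deg-b
                    ∷ trans deg-c≡deg-b (sym deg-d≡deg-b) ∷ refl ∷ []

      edge-in-K : ∀ u v → adj Γ u v ≡ true → memberOf K u ≡ true
      edge-in-K u v uv with meets-triangle (edge u v uv)
      ... | r , r∈abc , r∈uv with u ≟ r
      ...   | yes refl = ∈⇒memberOf {as = K} (∈-++⁺ˡ r∈abc)
      ...   | no  u≢r  = clique-closed Γ K-unique K-clique v∈K (K-degree v∈K) u (adj-sym uv)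
        where
        v∈K : v ∈ K
        v∈K = subst (_∈ K) (∈ₑ-third-end (∈ₑ-edge₁ u v uv) r∈uv (∈ₑ-edge₂ u v uv) u≢r (adj⇒≢ uv))
                    (∈-++⁺ˡ r∈abc)

      completeCore : CompleteCore Γ
      completeCore = record
        { core          = memberOf K
        ; edge-in-core  = edge-in-K
        ; core-complete = λ u v u∈K v∈K → pairwise-adjacent⇒adj Γ K-clique (memberOf⇒∈ K u∈K) (memberOf⇒∈ K v∈K)
        ; 3≤|core|      = ℕₚ.≤-trans (s≤s (s≤s (s≤s z≤n))) (ℕₚ.≤-reflexive (sym (count-memberOf K-unique)))
        }

  outside-clique⇒¬same-ends : ∀ {u v g h} → Cₑ g ≡ false → Cₑ h ≡ true →
    u ∈ₑ g ≡ true → v ∈ₑ g ≡ true → u ∈ₑ h ≡ true → v ∈ₑ h ≡ true → u ≢ v → ⊥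
  outside-clique⇒¬same-ends g∉C h∈C u∈g v∈g u∈h v∈h u≢v =
    case trans (sym g∉C) (trans (cong Cₑ (edge-determined u∈g v∈g u∈h v∈h u≢v)) h∈C) of λ ()

  triangle⇒completeCore : Triangle → CompleteCore Γ
  triangle⇒completeCore T with edge-outside-clique
  ... | g₀ , g₀∉C with Triangle.a T ∈ₑ g₀ in a∈ | Triangle.b T ∈ₑ g₀ in b∈ | Triangle.c T ∈ₑ g₀ in c∈
  ... | true  | true  | _     = ⊥-elim (outside-clique⇒¬same-ends g₀∉C ab∈C a∈ b∈ a∈ab b∈ab a≢b)
    where open Triangle T
  ... | true  | false | true  = ⊥-elim (outside-clique⇒¬same-ends g₀∉C ac∈C a∈ c∈ a∈ac c∈ac a≢c)
    where open Triangle T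
  ... | false | true  | true  = ⊥-elim (outside-clique⇒¬same-ends g₀∉C bc∈C b∈ c∈ b∈bc c∈bc b≢c)
    where open Triangle T
  ... | true  | false | false = K₄.completeCore T g₀ a∈ b∈ c∈
  ... | false | true  | false = K₄.completeCore (rotate T) g₀ b∈ c∈ a∈
  ... | false | false | true  = K₄.completeCore (rotate (rotate T)) g₀ c∈ a∈ b∈
  ... | false | false | false = ⊥-elim (edge-avoiding-triangle-impossible T g₀ a∈ b∈ c∈)

  path-common : ∀ {a b c} → adj Γ a b ≡ true → adj Γ a c ≡ true → b ≢ c → l + 2 ≡ deg a + 𝟙 (adj Γ b c)
  path-common {a} {b} {c} a~b a~c b≢c =
    trans (cong (_+ 2) (sym (lineCommon≡l ab ac
                              (common-end⇒lineAdj (∈ₑ-edge₁ a b a~b) (∈ₑ-edge₁ a c a~c) ab≢ac))))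
          (lineCommon-meeting (∈ₑ-edge₁ a b a~b) (∈ₑ-edge₂ a b a~b) (∈ₑ-edge₁ a c a~c) (∈ₑ-edge₂ a c a~c)
                              (adj⇒≢ a~b) (adj⇒≢ a~c) b≢c)
    where
    ab ac : E
    ab = edge a b a~b
    ac = edge a c a~c
    ab≢ac : ab ≢ ac
    ab≢ac = ∈ₑ∧∉ₑ⇒edge≢ (∈ₑ-edge₂ a b a~b)
      (third-∉ₑ ac (adj⇒≢ a~c) (adj⇒≢ a~b) (b≢c ∘ sym) (∈ₑ-edge₁ a c a~c) (∈ₑ-edge₂ a c a~c))

  module StarCase (x : V) (clique⊆star : ∀ g → Cₑ g ≡ true → x ∈ₑ g ≡ true) where

    clique-edges-at : V → ℕ
    clique-edges-at u = countE (λ h → Cₑ h ∧ u ∈ₑ h)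

    clique-edges-at≤1 : ∀ u → x ≢ u → clique-edges-at u ≤ 1
    clique-edges-at≤1 u x≢u = begin
      clique-edges-at u                  ≤⟨ count-mono (λ i Cu → cong₂ _∧_ (clique⊆star (to i) (∧-conicalˡ _ _ Cu))
                                                                              (∧-conicalʳ _ _ Cu)) ⟩
      countE (λ h → x ∈ₑ h ∧ u ∈ₑ h)     ≡⟨ countE-both-∈ₑ x u x≢u ⟩
      𝟙 (adj Γ x u)                      ≤⟨ 𝟙≤1 (adj Γ x u) ⟩
      1                                  ∎
      where
      open ℕₚ.≤-Reasoning
      𝟙≤1 : ∀ b → 𝟙 b ≤ 1
      𝟙≤1 true  = s≤s z≤n
      𝟙≤1 false = z≤n

    -- The clique edges adjacent to an edge uv avoiding x are those at u and those at v.
    nexus-split : ∀ {u v g} → u ∈ₑ g ≡ true → v ∈ₑ g ≡ true → u ≢ v → x ∈ₑ g ≡ false →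
      e ≡ clique-edges-at u + clique-edges-at v
    nexus-split {u} {v} {g} u∈g v∈g u≢v x∉g = begin
      e
        ≡⟨ sym (Cₑ-nexus g g∉C) ⟩
      countE (λ h → Cₑ h ∧ lineAdj Γ g h)
        ≡⟨ countE-cong (λ h → cong (Cₑ h ∧_) (lineAdj-xor u∈g v∈g u≢v h)) ⟩
      countE (λ h → Cₑ h ∧ (u ∈ₑ h xor v ∈ₑ h))
        ≡⟨ sym (ℕₚ.+-identityʳ _) ⟩
      countE (λ h → Cₑ h ∧ (u ∈ₑ h xor v ∈ₑ h)) + 0
        ≡⟨ Σcount-cong (_ ∷ []) (_ ∷ _ ∷ [])
             (λ i → 𝟙-∧-xor (Cₑ (to i)) (u ∈ₑ to i) (v ∈ₑ to i) (not-both (to i))) ⟩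
      clique-edges-at u + (clique-edges-at v + 0)
        ≡⟨ cong (clique-edges-at u +_) (ℕₚ.+-identityʳ _) ⟩
      clique-edges-at u + clique-edges-at v
        ∎
      where
      open ≡-Reasoning
      g∉C : Cₑ g ≡ false
      g∉C = ¬-not λ g∈C → case trans (sym (clique⊆star g g∈C)) x∉g of λ ()
      not-both : ∀ h → Cₑ h ≡ true → u ∈ₑ h ≡ true → v ∈ₑ h ≡ false
      not-both h h∈C u∈h =
        third-∉ₑ h (∈ₑ∧∉ₑ⇒≢ u∈g x∉g ∘ sym) (∈ₑ∧∉ₑ⇒≢ v∈g x∉g ∘ sym) u≢v (clique⊆star h h∈C) u∈h

    module _ (g₁ : E) (x∈g₁ : x ∈ₑ g₁ ≡ true) (g₁∉C : Cₑ g₁ ≡ false) where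
      private
        z : V
        z = other x g₁

        x≢z : x ≢ z
        x≢z = other-≢ x g₁ x∈g₁

        -- every clique edge meets g₁, at x
        e≡|C| : e ≡ countE Cₑ
        e≡|C| = trans (sym (Cₑ-nexus g₁ g₁∉C)) (countE-cong clique-adjacent)
          where
          clique-adjacent : ∀ h → Cₑ h ∧ lineAdj Γ g₁ h ≡ Cₑ h
          clique-adjacent h with Cₑ h in h∈C
          ... | false = refl
          ... | true  = common-end⇒lineAdj x∈g₁ (clique⊆star h h∈C)
                          λ { refl → case trans (sym h∈C) g₁∉C of λ () }

        clique-edge-at : ∀ {u v g} → u ∈ₑ g ≡ true → v ∈ₑ g ≡ true → u ≢ v → x ∈ₑ g ≡ false →
          ∃ λ h → Cₑ h ≡ true × u ∈ₑ h ≡ true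
        clique-edge-at {u} {v} u∈g v∈g u≢v x∉g with count-witness {p = λ i → Cₑ (to i) ∧ u ∈ₑ to i} 1≤|C∩u|
          where
          1≤|C∩u| : 1 ≤ clique-edges-at u
          1≤|C∩u| = ℕₚ.+-cancelʳ-≤ 1 1 _ (begin
            2                                       ≤⟨ 2≤|Cₑ| ⟩
            countE Cₑ                               ≡⟨ sym e≡|C| ⟩
            e                                       ≡⟨ nexus-split u∈g v∈g u≢v x∉g ⟩
            clique-edges-at u + clique-edges-at v   ≤⟨ ℕₚ.+-monoʳ-≤ (clique-edges-at u)
                                                         (clique-edges-at≤1 v (∈ₑ∧∉ₑ⇒≢ v∈g x∉g ∘ sym)) ⟩
            clique-edges-at u + 1                   ∎)
            where open ℕₚ.≤-Reasoning
        ... | i , Ch∧u∈h = to i , ∧-conicalˡ _ _ Ch∧u∈h , ∧-conicalʳ (Cₑ (to i)) _ Ch∧u∈h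

        -- an edge zw with w ≠ x would avoid x, and the clique edge at z it forces is g₁ itself
        no-other-neighbour : ∀ {w} → adj Γ z w ≡ true → x ≢ w → ⊥
        no-other-neighbour {w} z~w x≢w with clique-edge-at z∈zw w∈zw (adj⇒≢ z~w) x∉zw
          where
          z∈zw : z ∈ₑ edge z w z~w ≡ true
          z∈zw = ∈ₑ-edge₁ z w z~w
          w∈zw : w ∈ₑ edge z w z~w ≡ true
          w∈zw = ∈ₑ-edge₂ z w z~w
          x∉zw : x ∈ₑ edge z w z~w ≡ false
          x∉zw = third-∉ₑ (edge z w z~w) (adj⇒≢ z~w) (x≢z ∘ sym) (x≢w ∘ sym) z∈zw w∈zw
        ... | h , h∈C , z∈h =
          outside-clique⇒¬same-ends g₁∉C h∈C x∈g₁ (other-∈ₑ x g₁) (clique⊆star h h∈C) z∈h x≢z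

        deg-z≤1 : deg z ≤ 1
        deg-z≤1 = ℕₚ.≤-trans (count-mono {q = eqF x} (λ w z~w → ¬-not (no-other-neighbour z~w ∘ eqF-false⇒≢)))
                             (ℕₚ.≤-reflexive (count-singleton x))

      every-edge-through-x : ∀ g → x ∈ₑ g ≡ true
      every-edge-through-x g = ¬-not λ x∉g →
        edge-avoiding-x-impossible (clique-edge-at (end₁-∈ₑ g) (end₂-∈ₑ g) (end₁≢end₂ g) x∉g) x∉g
        where
        u v : V
        u = end₁ g
        v = end₂ g
        -- along g₁, k + 2 = deg x + deg z ≤ deg x + 1; along xu, k + 2 = deg x + deg u ≥ deg x + 2
        edge-avoiding-x-impossible : (∃ λ h → Cₑ h ≡ true × u ∈ₑ h ≡ true) → x ∈ₑ g ≡ false → ⊥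
        edge-avoiding-x-impossible (h , h∈C , u∈h) x∉g = case ℕₚ.+-cancelˡ-≤ (deg x) 2 1 (begin
          deg x + 2      ≤⟨ ℕₚ.+-monoʳ-≤ (deg x) (two-neighbours⇒2≤degree Γ (adj-sym x~u) (adj-ends g) x≢v) ⟩
          deg x + deg u  ≡⟨ sym (adj⇒degree-sum x~u) ⟩
          k + 2          ≡⟨ degree-sum x∈g₁ (other-∈ₑ x g₁) x≢z ⟩
          deg x + deg z  ≤⟨ ℕₚ.+-monoʳ-≤ (deg x) deg-z≤1 ⟩
          deg x + 1      ∎) of λ { (s≤s ()) }
          where
          open ℕₚ.≤-Reasoning
          x≢v : x ≢ v
          x≢v = ∈ₑ∧∉ₑ⇒≢ (end₂-∈ₑ g) x∉g ∘ sym
          x~u : adj Γ x u ≡ true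
          x~u = ∈ₑ⇒adj (clique⊆star h h∈C) u∈h (∈ₑ∧∉ₑ⇒≢ (end₁-∈ₑ g) x∉g ∘ sym)

    star⊆clique : ∀ g → x ∈ₑ g ≡ true → Cₑ g ≡ true
    star⊆clique g x∈g = ¬-not λ g∉C → ¬lineComplete λ h h′ →
      common-end⇒lineAdj (every-edge-through-x g x∈g g∉C h) (every-edge-through-x g x∈g g∉C h′)

    clique≡star : ∀ g → Cₑ g ≡ x ∈ₑ g
    clique≡star g = ⇔⇒≡ (clique⊆star g) (star⊆clique g)

    nexus-adj : ∀ {u v g} → u ∈ₑ g ≡ true → v ∈ₑ g ≡ true → u ≢ v → x ∈ₑ g ≡ false →
      e ≡ 𝟙 (adj Γ x u) + 𝟙 (adj Γ x v)
    nexus-adj u∈g v∈g u≢v x∉g = trans (nexus-split u∈g v∈g u≢v x∉g)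
      (cong₂ _+_ (edges-at (∈ₑ∧∉ₑ⇒≢ u∈g x∉g)) (edges-at (∈ₑ∧∉ₑ⇒≢ v∈g x∉g)))
      where
      edges-at : ∀ {w} → w ≢ x → clique-edges-at w ≡ 𝟙 (adj Γ x w)
      edges-at {w} w≢x =
        trans (countE-cong λ h → cong (_∧ w ∈ₑ h) (clique≡star h)) (countE-both-∈ₑ x w (w≢x ∘ sym))

    |C|≡deg-x : countE Cₑ ≡ deg x
    |C|≡deg-x = trans (countE-cong clique≡star) (countE-∈ₑ x)

    2≤deg-x : 2 ≤ deg x
    2≤deg-x = subst (2 ≤_) |C|≡deg-x 2≤|Cₑ|

    -- Every edge avoiding x has both ends joined to x: Γ is a complete graph.
    module JohnsonCase (e≡2 : e ≡ 2) (g₀ : E) (x∉g₀ : x ∈ₑ g₀ ≡ false) where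
      both-joined-to-x : ∀ {u v g} → u ∈ₑ g ≡ true → v ∈ₑ g ≡ true → u ≢ v → x ∈ₑ g ≡ false →
        adj Γ x u ≡ true × adj Γ x v ≡ true
      both-joined-to-x u∈g v∈g u≢v x∉g = 𝟙+𝟙≡2 (trans (sym (nexus-adj u∈g v∈g u≢v x∉g)) e≡2)
        where
        𝟙+𝟙≡2 : ∀ {a b} → 𝟙 a + 𝟙 b ≡ 2 → a ≡ true × b ≡ true
        𝟙+𝟙≡2 {true}  {true}  _  = refl , refl
        𝟙+𝟙≡2 {true}  {false} ()
        𝟙+𝟙≡2 {false} {true}  ()
        𝟙+𝟙≡2 {false} {false} ()

      core : V → Bool
      core w = eqF x w ∨ adj Γ x w

      |core| : count core ≡ suc (deg x)
      |core| = count-insert x (adj Γ x) (irrefl Γ x)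

      edge-in-core : ∀ u v → adj Γ u v ≡ true → core u ≡ true
      edge-in-core u v uv with x ≟ u | x ∈ₑ edge u v uv in x∈?
      ... | yes _    | _     = refl
      ... | no  x≢u  | true  = subst (λ y → adj Γ y u ≡ true) (sym x≡v) (adj-sym uv)
        where
        x≡v : x ≡ v
        x≡v = sym (∈ₑ-third-end (∈ₑ-edge₁ u v uv) (∈ₑ-edge₂ u v uv) x∈? (adj⇒≢ uv) (x≢u ∘ sym))
      ... | no  _    | false = proj₁ (both-joined-to-x (∈ₑ-edge₁ u v uv) (∈ₑ-edge₂ u v uv) (adj⇒≢ uv) x∈?)

      x-neighbour-degree : ∀ {y} → adj Γ x y ≡ true → deg y ≡ deg x
      x-neighbour-degree x~y = trans (common-neighbour⇒same-degree x~y x~p) deg-p≡deg-x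
        where
        p q : V
        p = end₁ g₀
        q = end₂ g₀
        x~p : adj Γ x p ≡ true
        x~p = proj₁ (both-joined-to-x (end₁-∈ₑ g₀) (end₂-∈ₑ g₀) (end₁≢end₂ g₀) x∉g₀)
        x~q : adj Γ x q ≡ true
        x~q = proj₂ (both-joined-to-x (end₁-∈ₑ g₀) (end₂-∈ₑ g₀) (end₁≢end₂ g₀) x∉g₀)
        deg-p≡deg-x : deg p ≡ deg x
        deg-p≡deg-x = ℕₚ.+-cancelʳ-≡ (deg q) _ _
          (trans (sym (degree-sum (end₁-∈ₑ g₀) (end₂-∈ₑ g₀) (end₁≢end₂ g₀))) (adj⇒degree-sum x~q))

      x-neighbour∈core : ∀ {y} → adj Γ x y ≡ true → core y ≡ true
      x-neighbour∈core {y} x~y = trans (cong (eqF x y ∨_) x~y) (∨-zeroʳ _)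

      core-complete : ∀ u v → core u ≡ true → core v ≡ true → u ≢ v → adj Γ u v ≡ true
      core-complete u v u∈ v∈ u≢v with x ≟ u | x ≟ v
      ... | yes refl | yes refl = contradiction refl u≢v
      ... | yes refl | no _     = v∈
      ... | no _     | yes refl = adj-sym u∈
      ... | no _     | no _     =
        ⊆∧count≥⇒⊇ nbrs⊆core |core-u|≤deg v (cong₂ (λ a b → a ∧ not b) (x-neighbour∈core v∈) (≢⇒eqF-false u≢v))
        where
        nbrs⊆core : adj Γ u ⊆ core ∖ eqF u
        nbrs⊆core w u~w = cong₂ (λ a b → a ∧ not b) (edge-in-core w u (adj-sym u~w)) (≢⇒eqF-false (adj⇒≢ u~w))
        |core-u|≤deg : count (core ∖ eqF u) ≤ deg u
        |core-u|≤deg = ℕₚ.≤-reflexive (trans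
          (ℕₚ.suc-injective (trans (sym (count-remove u (x-neighbour∈core u∈))) |core|))
          (sym (x-neighbour-degree u∈)))

      completeCore : CompleteCore Γ
      completeCore = record
        { core = core ; edge-in-core = edge-in-core ; core-complete = core-complete
        ; 3≤|core| = subst (3 ≤_) (sym |core|) (s≤s 2≤deg-x) }

    -- Every edge avoiding x has exactly one end joined to x: Γ is complete bipartite, with the
    -- neighbours of x on one side and the other non-isolated vertices on the other.
    module RookCase (e≡1 : e ≡ 1) (g₀ : E) (x∉g₀ : x ∈ₑ g₀ ≡ false) where
      one-joined-to-x : ∀ {u v g} → u ∈ₑ g ≡ true → v ∈ₑ g ≡ true → u ≢ v → x ∈ₑ g ≡ false →
        (adj Γ x u ≡ true × adj Γ x v ≡ false) ⊎ (adj Γ x u ≡ false × adj Γ x v ≡ true)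
      one-joined-to-x u∈g v∈g u≢v x∉g = 𝟙+𝟙≡1 (trans (sym (nexus-adj u∈g v∈g u≢v x∉g)) e≡1)
        where
        𝟙+𝟙≡1 : ∀ {a b} → 𝟙 a + 𝟙 b ≡ 1 → (a ≡ true × b ≡ false) ⊎ (a ≡ false × b ≡ true)
        𝟙+𝟙≡1 {true}  {false} _ = inj₁ (refl , refl)
        𝟙+𝟙≡1 {false} {true}  _ = inj₂ (refl , refl)
        𝟙+𝟙≡1 {true}  {true}  ()
        𝟙+𝟙≡1 {false} {false} ()

      right left : V → Bool
      right w = adj Γ x w
      left  w = not (adj Γ x w) ∧ (0 <ᵇ deg w)

      Across : V → V → Set
      Across u v = (left u ≡ true × right v ≡ true) ⊎ (right u ≡ true × left v ≡ true)

      positive : ∀ {m} → 1 ≤ m → (0 <ᵇ m) ≡ true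
      positive (s≤s _) = refl

      left-intro : ∀ {u w} → adj Γ x u ≡ false → adj Γ u w ≡ true → left u ≡ true
      left-intro {u} {w} x≁u u~w = cong₂ _∧_ (cong not x≁u) (positive (count-pos {p = adj Γ u} w u~w))

      left-x : left x ≡ true
      left-x = cong₂ _∧_ (cong not (irrefl Γ x)) (positive (ℕₚ.≤-trans (s≤s z≤n) 2≤deg-x))

      disjoint : ∀ u → left u ≡ true → right u ≡ true → ⊥
      disjoint u u∈left u∈right = case trans (sym (∧-conicalˡ _ _ u∈left)) (cong not u∈right) of λ ()

      edge-across : ∀ u v → adj Γ u v ≡ true → Across u v
      edge-across u v uv = across (x ∈ₑ edge u v uv) refl
        where
        u∈uv : u ∈ₑ edge u v uv ≡ true
        u∈uv = ∈ₑ-edge₁ u v uv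
        v∈uv : v ∈ₑ edge u v uv ≡ true
        v∈uv = ∈ₑ-edge₂ u v uv
        across : ∀ b → x ∈ₑ edge u v uv ≡ b → Across u v
        across true x∈uv = by-ends (two-ends u∈uv v∈uv x∈uv)
          where
          by-ends : u ≡ v ⊎ u ≡ x ⊎ v ≡ x → Across u v
          by-ends (inj₁ u≡v)         = contradiction u≡v (adj⇒≢ uv)
          by-ends (inj₂ (inj₁ refl)) = inj₁ (left-x , uv)
          by-ends (inj₂ (inj₂ refl)) = inj₂ (adj-sym uv , left-x)
        across false x∉uv = by-ends (one-joined-to-x u∈uv v∈uv (adj⇒≢ uv) x∉uv)
          where
          by-ends : (adj Γ x u ≡ true × adj Γ x v ≡ false) ⊎ (adj Γ x u ≡ false × adj Γ x v ≡ true) → Across u v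
          by-ends (inj₁ (x~u , x≁v)) = inj₂ (x~u , left-intro x≁v (adj-sym uv))
          by-ends (inj₂ (x≁u , x~v)) = inj₁ (left-intro x≁u uv , x~v)

      nbrs-left⊆right : ∀ {z} → left z ≡ true → adj Γ z ⊆ right
      nbrs-left⊆right {z} z∈left w z~w =
        [ proj₂ , (λ (z∈right , _) → ⊥-elim (disjoint z z∈left z∈right)) ]′ (edge-across z w z~w)

      nbrs-right⊆left : ∀ {y} → right y ≡ true → adj Γ y ⊆ left
      nbrs-right⊆left {y} y∈right w y~w =
        [ (λ (y∈left , _) → ⊥-elim (disjoint y y∈left y∈right)) , proj₂ ]′ (edge-across y w y~w)

      left-degree : ∀ {z} → left z ≡ true → deg z ≡ deg x
      left-degree {z} z∈left with count-witness {p = adj Γ z} (positive⁻¹ (∧-conicalʳ _ _ z∈left))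
        where
        positive⁻¹ : ∀ {m} → (0 <ᵇ m) ≡ true → 1 ≤ m
        positive⁻¹ {suc _} _ = s≤s z≤n
      ... | w , z~w = ℕₚ.+-cancelʳ-≡ (deg w) _ _
        (trans (sym (adj⇒degree-sum z~w)) (adj⇒degree-sum (nbrs-left⊆right z∈left w z~w)))

      across-adj : ∀ u v → left u ≡ true → right v ≡ true → adj Γ u v ≡ true
      across-adj z y z∈left y∈right =
        ⊆∧count≥⇒⊇ (nbrs-left⊆right z∈left) (ℕₚ.≤-reflexive (sym (left-degree z∈left))) y y∈right

      left≡nbrs-right : ∀ {y} → right y ≡ true → ∀ w → left w ≡ adj Γ y w
      left≡nbrs-right y∈right w =
        ⇔⇒≡ (λ w∈left → adj-sym (across-adj w _ w∈left y∈right)) (nbrs-right⊆left y∈right w)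

      right-nonadjacent : ∀ {y y′} → right y ≡ true → right y′ ≡ true → adj Γ y y′ ≡ false
      right-nonadjacent {y} {y′} y∈right y′∈right =
        ¬-not λ y~y′ → disjoint y′ (nbrs-right⊆left y∈right y′ y~y′) y′∈right

      -- Comparing the common neighbours of xy₀, xy′ with those of y₀x, y₀z₀ gives deg y₀ = deg x.
      |left|≡deg-x : ∀ {y₀ z₀} → adj Γ y₀ z₀ ≡ true → adj Γ x y₀ ≡ true → adj Γ x z₀ ≡ false → x ≢ z₀ →
        count left ≡ deg x
      |left|≡deg-x {y₀} {z₀} y₀~z₀ x~y₀ x≁z₀ x≢z₀ =
        via-second-neighbour (count-witness (ℕₚ.≤-pred (subst (2 ≤_) (count-remove y₀ x~y₀) 2≤deg-x)))
        where
        via-second-neighbour : (∃ λ y′ → (right ∖ eqF y₀) y′ ≡ true) → count left ≡ deg x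
        via-second-neighbour (y′ , y′∈) = trans (count-cong (left≡nbrs-right x~y₀)) (ℕₚ.+-cancelʳ-≡ 0 _ _ (begin
          deg y₀ + 0                ≡⟨ cong (λ b → deg y₀ + 𝟙 b) (sym x≁z₀) ⟩
          deg y₀ + 𝟙 (adj Γ x z₀)   ≡⟨ sym (path-common (adj-sym x~y₀) y₀~z₀ x≢z₀) ⟩
          l + 2                     ≡⟨ path-common x~y₀ x~y′ y₀≢y′ ⟩
          deg x + 𝟙 (adj Γ y₀ y′)   ≡⟨ cong (λ b → deg x + 𝟙 b) (right-nonadjacent x~y₀ x~y′) ⟩
          deg x + 0                 ∎))
          where
          open ≡-Reasoning
          x~y′ : adj Γ x y′ ≡ true
          x~y′ = ∧-conicalˡ _ _ y′∈
          y₀≢y′ : y₀ ≢ y′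
          y₀≢y′ = eqF-false⇒≢ (not-injective (∧-conicalʳ _ _ y′∈))

      bipartiteCore : BipartiteCore Γ
      bipartiteCore = record
        { left = left ; right = right ; size = deg x ; |left| = |left| ; |right| = refl ; 2≤size = 2≤deg-x
        ; disjoint = disjoint ; edge-across = edge-across ; across-adj = across-adj }
        where
        |left| : count left ≡ deg x
        |left| = [ (λ (x~p , x≁q) → |left|≡deg-x (adj-ends g₀) x~p x≁q (x≢ (end₂-∈ₑ g₀)))
                 , (λ (x≁p , x~q) → |left|≡deg-x (adj-sym (adj-ends g₀)) x~q x≁p (x≢ (end₁-∈ₑ g₀)))
                 ]′ (one-joined-to-x (end₁-∈ₑ g₀) (end₂-∈ₑ g₀) (end₁≢end₂ g₀) x∉g₀)
          where
          x≢ : ∀ {z} → z ∈ₑ g₀ ≡ true → x ≢ z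
          x≢ z∈g₀ = ∈ₑ∧∉ₑ⇒≢ z∈g₀ x∉g₀ ∘ sym

    star⇒core : CompleteCore Γ ⊎ BipartiteCore Γ
    star⇒core with edge-outside-clique
    ... | g₀ , g₀∉C = by-nexus (adj Γ x (end₁ g₀)) (adj Γ x (end₂ g₀))
                               (nexus-adj (end₁-∈ₑ g₀) (end₂-∈ₑ g₀) (end₁≢end₂ g₀) x∉g₀)
      where
      x∉g₀ : x ∈ₑ g₀ ≡ false
      x∉g₀ = trans (sym (clique≡star g₀)) g₀∉C
      by-nexus : ∀ a b → e ≡ 𝟙 a + 𝟙 b → CompleteCore Γ ⊎ BipartiteCore Γ
      by-nexus true  true  e≡2 = inj₁ (JohnsonCase.completeCore e≡2 g₀ x∉g₀)
      by-nexus true  false e≡1 = inj₂ (RookCase.bipartiteCore e≡1 g₀ x∉g₀)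
      by-nexus false true  e≡1 = inj₂ (RookCase.bipartiteCore e≡1 g₀ x∉g₀)
      by-nexus false false e≡0 = case subst (1 ≤_) e≡0 1≤e of λ ()

  core-of-Γ : CompleteCore Γ ⊎ BipartiteCore Γ
  core-of-Γ with count-witness {p = Cₑ ∘ to} (ℕₚ.≤-trans (s≤s z≤n) 2≤|Cₑ|)
  ... | i , Ci with shape enum (to i) Ci
  ...   | star x clique⊆star = StarCase.star⇒core x clique⊆star
  ...   | triangle T         = inj₁ (triangle⇒completeCore T)

  stronglyRegular : ∀ μ → (∀ {g h} → lineAdj Γ g h ≡ false → g ≢ h → lineCommon g h ≡ μ) → IsStronglyRegular L
  stronglyRegular μ μ-const = k , l , μ , regular , common , λ u v u≢v u≁v →
    trans (count-cong λ w → sym (cong₂ _∧_ (enum-adj u w) (enum-adj v w)))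
          (μ-const (trans (enum-adj u v) u≁v) (u≢v ∘ to-injective))

  classification : RookJohnsonOrOctahedral L × IsStronglyRegular L
  classification = [ (λ K → completeCore⇒johnson Γ L line ¬complete K ,
                            stronglyRegular 4 (CompleteCoreLineGraph.lineCommon-disjoint≡4 Γ K enum))
                   , (λ B → bipartiteCore⇒rook Γ L line ¬complete B ,
                            stronglyRegular 2 (BipartiteCoreLineGraph.lineCommon-disjoint≡2 Γ B enum))
                   ]′ core-of-Γ
    where
    line : IsLineGraphOf L Γ
    line = enum , enum-adj

proposition2p34 : (Γ L : Graph) → IsLineGraphOf L Γ → IsNeumaier L →
    ((Σ ℕ λ s → (1 ≤ s) × (L ≅ (Fin (suc s) × Fin (suc s)) on rookAdj (suc s)))
     ⊎ (Σ ℕ λ s → (2 ≤ s) × (L ≅ JVert (suc (suc s)) on johnsonAdj (suc (suc s))))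
     ⊎ (L ≅ Fin 6 on octaAdj))
    × IsStronglyRegular L
proposition2p34 Γ L (enum , enum-adj) (¬complete , (k , l , regular , common) , C , regularClique) =
  NeumaierLineGraph.classification Γ L enum enum-adj ¬complete k l regular common C regularClique
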